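{- Let $N$ be a nonnegative integer and let $q,b,c$ be indeterminates. Then \[ \sum_{n=0}^{N}(-1)^n b^n q^{\binom{n}{2}}\frac{(cq;q)_N}{(cq;q)_n(cq;q)_{N-n}} =\sum_{j=0}^{\lfloor N/2\rfloor}\sum_{k=0}^{N-j}\frac{(-1)^k b^j q^{j^2+T_k}(c;q)_j(q,b;q)_{N-j}(b;q)_{N-k}}{(q,b,cq;q)_j(q,b;q)_{N-j-k}(q;q)_k(q;q)_{N-2j}}. \]
   Context: For an integer $n$, $T_n=n(n+1)/2$. For a nonnegative integer $n$, $(a;q)_n=\prod_{k=0}^{n-1}(1-aq^k)$, and $(a_1,\dots,a_r;q)_n=(a_1;q)_n\cdots(a_r;q)_n$. The identity is an identity of rational functions in $q,b,c$. -}

module Defs where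

open import Data.Nat using (ℕ; zero; suc) renaming (_+_ to _+ℕ_; _*_ to _*ℕ_)
open import Data.Nat.DivMod using () renaming (_/_ to _divℕ_)
open import Data.Rational using (ℚ; 0ℚ; 1ℚ; _+_; _*_; _-_; -_; 1/_; ≢-nonZero)
open import Data.Rational.Properties using (_≟_)
open import Relation.Nullary using (yes; no)

_^_ : ℚ → ℕ → ℚ
x ^ zero = 1ℚ
x ^ suc n = (x ^ n) * x

-- total inverse (inv 0 = 0); only ever applied to nonzero values in the theorem
inv : ℚ → ℚ
inv x with x ≟ 0ℚ
... | yes _ = 0ℚ
... | no x≢0 = 1/_ x {{≢-nonZero x≢0}}

_÷'_ : ℚ → ℚ → ℚ
x ÷' y = x * inv y

poch : ℚ → ℚ → ℕ → ℚ
poch a q zero = 1ℚ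
poch a q (suc n) = poch a q n * (1ℚ - a * (q ^ n))

sumTo : ℕ → (ℕ → ℚ) → ℚ
sumTo zero f = f 0
sumTo (suc n) f = sumTo n f + f (suc n)

sgn : ℕ → ℚ
sgn n = (- 1ℚ) ^ n

T : ℕ → ℕ
T k = (k *ℕ suc k) divℕ 2

-- Expand both sides in powers of b. On the right each summand factors into a j-part and a
-- k-part, and for 2j ≤ N the k-sum equals 1: with M = N - j it is (q;q)_M⁻¹ times the
-- alternating sum Σₖ (-1)ᵏ q^(k+1 choose 2) [M k] P(q^(M-k)) with P(w) = (bw;q)_j of degree
-- j ≤ M, and by the homogeneous q-binomial theorem such a sum only sees P(0) = 1. What is left is
-- Σⱼ bʲ q^(j²) (c;q)ⱼ/(cq;q)ⱼ [N-j j] (bqʲ;q)_(N-2j). Expanding (bqʲ;q)_(N-2j) by the q-binomial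
-- theorem and using [N-j j][N-2j m-j] = [m j][N-j m], the coefficient of (-1)ᵐ bᵐ q^(m choose 2)
-- becomes a terminating q-Pfaff–Saalschütz sum over j, whose value (cq;q)_N / ((cq;q)_m (cq;q)_(N-m))
-- is the coefficient on the left. The Saalschütz sum is proved by induction on m, the recurrence
-- coming from a WZ-style telescoping certificate.

module Submission where

open import Data.Nat using (ℕ; zero; suc; z≤n; s≤s; _≤_; _<_)
  renaming (_+_ to _+ℕ_; _*_ to _*ℕ_; _∸_ to _∸ℕ_)
import Data.Nat.Properties as ℕ
open import Data.Nat.DivMod using (m*n/n≡m; m/n*n≤m; m/n≤m; /-monoˡ-≤) renaming (_/_ to _divℕ_)
open import Data.Nat.Combinatorics using (_C_; nC1≡n; nCk+nC[k+1]≡[n+1]C[k+1])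
import Data.Nat.Tactic.RingSolver as ℕ-Solver
open import Data.Rational using (ℚ; 0ℚ; 1ℚ; _+_; _*_; _-_; -_; ≢-nonZero)
open import Data.Rational.Properties
  using (_≟_; +-*-commutativeRing; *-inverseʳ; *-assoc; *-comm; *-identityˡ; *-identityʳ; *-zeroˡ; *-zeroʳ;
         *-distribˡ-+; +-assoc; +-identityʳ; +-inverseʳ; +-0-group)
open import Algebra.Properties.Group +-0-group using () renaming (x∙y⁻¹≈ε⇒x≈y to x-y≡0⇒x≡y)
open import Data.Sum using (inj₁; inj₂)
open import Level using (0ℓ)
open import Relation.Binary.PropositionalEquality
open import Relation.Nullary using (yes; no; contradiction)
open import Relation.Nullary.Decidable using (dec⇒maybe)
open import Tactic.RingSolver using (solve-∀)
open import Tactic.RingSolver.Core.AlmostCommutativeRing using (AlmostCommutativeRing; fromCommutativeRing)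

open import Defs

open ≡-Reasoning

ring : AlmostCommutativeRing 0ℓ 0ℓ
ring = fromCommutativeRing +-*-commutativeRing (λ x → dec⇒maybe (0ℚ ≟ x))

*-invʳ : ∀ {x} → x ≢ 0ℚ → x * inv x ≡ 1ℚ
*-invʳ {x} x≢0 with x ≟ 0ℚ
... | yes x≡0 = contradiction x≡0 x≢0
... | no  x≢0′ = *-inverseʳ x {{≢-nonZero x≢0′}}

x≡z*d⇒x÷'d≡z : ∀ {x d z} → d ≢ 0ℚ → x ≡ z * d → x ÷' d ≡ z
x≡z*d⇒x÷'d≡z {x} {d} {z} d≢0 x≡zd = begin
  x * inv d        ≡⟨ cong (_* inv d) x≡zd ⟩
  z * d * inv d    ≡⟨ *-assoc z d (inv d) ⟩
  z * (d * inv d)  ≡⟨ cong (z *_) (*-invʳ d≢0) ⟩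
  z * 1ℚ           ≡⟨ *-identityʳ z ⟩
  z                ∎

*-cancelʳ-≡ : ∀ {x y d} → d ≢ 0ℚ → x * d ≡ y * d → x ≡ y
*-cancelʳ-≡ {x} {y} {d} d≢0 xd≡yd = begin
  x              ≡⟨ x≡z*d⇒x÷'d≡z d≢0 refl ⟨
  (x * d) ÷' d   ≡⟨ cong (_÷' d) xd≡yd ⟩
  (y * d) ÷' d   ≡⟨ x≡z*d⇒x÷'d≡z d≢0 refl ⟩
  y              ∎

x*y≢0 : ∀ {x y} → x ≢ 0ℚ → y ≢ 0ℚ → x * y ≢ 0ℚ
x*y≢0 {x} {y} x≢0 y≢0 xy≡0 = x≢0 (*-cancelʳ-≡ y≢0 (trans xy≡0 (sym (*-zeroˡ y))))

x*y≢0⇒x≢0 : ∀ {x y} → x * y ≢ 0ℚ → x ≢ 0ℚ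
x*y≢0⇒x≢0 {x} {y} xy≢0 x≡0 = xy≢0 (trans (cong (_* y) x≡0) (*-zeroˡ y))

x*v≡u*y⇒x÷'y≡u÷'v : ∀ {x y u v} → y ≢ 0ℚ → v ≢ 0ℚ → x * v ≡ u * y → x ÷' y ≡ u ÷' v
x*v≡u*y⇒x÷'y≡u÷'v {x} {y} {u} {v} y≢0 v≢0 xv≡uy = x≡z*d⇒x÷'d≡z y≢0 (begin
  x               ≡⟨ x≡z*d⇒x÷'d≡z v≢0 refl ⟨
  (x * v) ÷' v    ≡⟨ cong (_÷' v) xv≡uy ⟩
  u * y * inv v   ≡⟨ swap u y (inv v) ⟩
  u * inv v * y   ∎)
  where
  swap : ∀ u y w → u * y * w ≡ u * w * y
  swap = solve-∀ ring

÷'-*-interchange : ∀ {x y u v} → y ≢ 0ℚ → v ≢ 0ℚ → (x * u) ÷' (y * v) ≡ (x ÷' y) * (u ÷' v)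
÷'-*-interchange {x} {y} {u} {v} y≢0 v≢0 = x≡z*d⇒x÷'d≡z (x*y≢0 y≢0 v≢0) (begin
  x * u                                     ≡⟨ collect x u ⟨
  x * 1ℚ * (u * 1ℚ)                         ≡⟨ cong₂ (λ s t → x * s * (u * t)) (*-invʳ y≢0) (*-invʳ v≢0) ⟨
  x * (y * inv y) * (u * (v * inv v))       ≡⟨ regroup x y (inv y) u v (inv v) ⟩
  x * inv y * (u * inv v) * (y * v)         ∎)
  where
  collect : ∀ x u → x * 1ℚ * (u * 1ℚ) ≡ x * u
  collect = solve-∀ ring
  regroup : ∀ x y y′ u v v′ → x * (y * y′) * (u * (v * v′)) ≡ x * y′ * (u * v′) * (y * v)
  regroup = solve-∀ ring

^-distribˡ-+-* : ∀ x m n → x ^ (m +ℕ n) ≡ x ^ m * x ^ n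
^-distribˡ-+-* x zero    n = sym (*-identityˡ (x ^ n))
^-distribˡ-+-* x (suc m) n = begin
  x ^ (m +ℕ n) * x      ≡⟨ cong (_* x) (^-distribˡ-+-* x m n) ⟩
  x ^ m * x ^ n * x     ≡⟨ swap (x ^ m) (x ^ n) x ⟩
  x ^ m * x * x ^ n     ∎
  where
  swap : ∀ a b c → a * b * c ≡ a * c * b
  swap = solve-∀ ring

^-distribʳ-* : ∀ x y n → (x * y) ^ n ≡ x ^ n * y ^ n
^-distribʳ-* x y zero    = sym (*-identityˡ 1ℚ)
^-distribʳ-* x y (suc n) = begin
  (x * y) ^ n * (x * y)      ≡⟨ cong (_* (x * y)) (^-distribʳ-* x y n) ⟩
  x ^ n * y ^ n * (x * y)    ≡⟨ regroup (x ^ n) (y ^ n) x y ⟩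
  x ^ n * x * (y ^ n * y)    ∎
  where
  regroup : ∀ a b c d → a * b * (c * d) ≡ a * c * (b * d)
  regroup = solve-∀ ring

^-*-assoc : ∀ x m n → (x ^ m) ^ n ≡ x ^ (m *ℕ n)
^-*-assoc x m zero    = cong (x ^_) (sym (ℕ.*-zeroʳ m))
^-*-assoc x m (suc n) = begin
  (x ^ m) ^ n * x ^ m     ≡⟨ cong (_* x ^ m) (^-*-assoc x m n) ⟩
  x ^ (m *ℕ n) * x ^ m    ≡⟨ ^-distribˡ-+-* x (m *ℕ n) m ⟨
  x ^ (m *ℕ n +ℕ m)       ≡⟨ cong (x ^_) (trans (ℕ.+-comm (m *ℕ n) m) (sym (ℕ.*-suc m n))) ⟩
  x ^ (m *ℕ suc n)        ∎

^-zeroˡ : ∀ n → 1ℚ ^ n ≡ 1ℚ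
^-zeroˡ zero    = refl
^-zeroˡ (suc n) = trans (*-identityʳ (1ℚ ^ n)) (^-zeroˡ n)

sgn-cancel : ∀ {j d m} → j +ℕ d ≡ m → sgn m * sgn j ≡ sgn d
sgn-cancel {j} {d} refl = begin
  sgn (j +ℕ d) * sgn j       ≡⟨ cong (_* sgn j) (^-distribˡ-+-* (- 1ℚ) j d) ⟩
  sgn j * sgn d * sgn j      ≡⟨ regroup (sgn j) (sgn d) ⟩
  sgn d * (sgn j * sgn j)    ≡⟨ cong (sgn d *_) (sgn-square j) ⟩
  sgn d * 1ℚ                 ≡⟨ *-identityʳ (sgn d) ⟩
  sgn d                      ∎
  where
  regroup : ∀ s t → s * t * s ≡ t * (s * s)
  regroup = solve-∀ ring
  sgn-square : ∀ n → sgn n * sgn n ≡ 1ℚ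
  sgn-square zero    = *-identityˡ 1ℚ
  sgn-square (suc n) = trans (square-neg (sgn n)) (sgn-square n)
    where
    square-neg : ∀ s → s * - 1ℚ * (s * - 1ℚ) ≡ s * s
    square-neg = solve-∀ ring

C2-suc : ∀ n → suc n C 2 ≡ n C 2 +ℕ n
C2-suc n = begin
  suc n C 2          ≡⟨ nCk+nC[k+1]≡[n+1]C[k+1] n 1 ⟨
  n C 1 +ℕ n C 2     ≡⟨ cong (_+ℕ n C 2) (nC1≡n n) ⟩
  n +ℕ n C 2         ≡⟨ ℕ.+-comm n (n C 2) ⟩
  n C 2 +ℕ n         ∎

C2-+ : ∀ m n → (m +ℕ n) C 2 ≡ m C 2 +ℕ n C 2 +ℕ m *ℕ n
C2-+ m zero    = begin
  (m +ℕ 0) C 2                  ≡⟨ cong (_C 2) (ℕ.+-identityʳ m) ⟩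
  m C 2                         ≡⟨ pad (m C 2) m ⟩
  m C 2 +ℕ 0 +ℕ m *ℕ 0          ∎
  where
  pad : ∀ a m → a ≡ a +ℕ 0 +ℕ m *ℕ 0
  pad = ℕ-Solver.solve-∀
C2-+ m (suc n) = begin
  (m +ℕ suc n) C 2                        ≡⟨ cong (_C 2) (ℕ.+-suc m n) ⟩
  suc (m +ℕ n) C 2                        ≡⟨ C2-suc (m +ℕ n) ⟩
  (m +ℕ n) C 2 +ℕ (m +ℕ n)                ≡⟨ cong (_+ℕ (m +ℕ n)) (C2-+ m n) ⟩
  m C 2 +ℕ n C 2 +ℕ m *ℕ n +ℕ (m +ℕ n)    ≡⟨ regroup (m C 2) (n C 2) m n ⟩
  m C 2 +ℕ (n C 2 +ℕ n) +ℕ m *ℕ suc n     ≡⟨ cong (λ t → m C 2 +ℕ t +ℕ m *ℕ suc n) (C2-suc n) ⟨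
  m C 2 +ℕ suc n C 2 +ℕ m *ℕ suc n        ∎
  where
  regroup : ∀ a b m n → a +ℕ b +ℕ m *ℕ n +ℕ (m +ℕ n) ≡ a +ℕ (b +ℕ n) +ℕ m *ℕ suc n
  regroup = ℕ-Solver.solve-∀

C2-double : ∀ n → n C 2 +ℕ n C 2 +ℕ n ≡ n *ℕ n
C2-double zero    = refl
C2-double (suc n) = begin
  suc n C 2 +ℕ suc n C 2 +ℕ suc n              ≡⟨ cong (λ t → t +ℕ t +ℕ suc n) (C2-suc n) ⟩
  n C 2 +ℕ n +ℕ (n C 2 +ℕ n) +ℕ suc n          ≡⟨ regroup (n C 2) n ⟩
  n C 2 +ℕ n C 2 +ℕ n +ℕ (n +ℕ suc n)          ≡⟨ cong (_+ℕ (n +ℕ suc n)) (C2-double n) ⟩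
  n *ℕ n +ℕ (n +ℕ suc n)                       ≡⟨ square-suc n ⟩
  suc n *ℕ suc n                               ∎
  where
  regroup : ∀ a n → a +ℕ n +ℕ (a +ℕ n) +ℕ suc n ≡ a +ℕ a +ℕ n +ℕ (n +ℕ suc n)
  regroup = ℕ-Solver.solve-∀
  square-suc : ∀ n → n *ℕ n +ℕ (n +ℕ suc n) ≡ suc n *ℕ suc n
  square-suc = ℕ-Solver.solve-∀

T≡C2 : ∀ k → T k ≡ k C 2 +ℕ k
T≡C2 k = begin
  (k *ℕ suc k) divℕ 2                  ≡⟨ cong (_divℕ 2) twice ⟩
  ((k C 2 +ℕ k) *ℕ 2) divℕ 2           ≡⟨ m*n/n≡m (k C 2 +ℕ k) 2 ⟩
  k C 2 +ℕ k                           ∎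
  where
  twice : k *ℕ suc k ≡ (k C 2 +ℕ k) *ℕ 2
  twice = begin
    k *ℕ suc k                         ≡⟨ ℕ.*-suc k k ⟩
    k +ℕ k *ℕ k                        ≡⟨ cong (k +ℕ_) (C2-double k) ⟨
    k +ℕ (k C 2 +ℕ k C 2 +ℕ k)         ≡⟨ regroup (k C 2) k ⟩
    (k C 2 +ℕ k) *ℕ 2                  ∎
    where
    regroup : ∀ a k → k +ℕ (a +ℕ a +ℕ k) ≡ (a +ℕ k) *ℕ 2
    regroup = ℕ-Solver.solve-∀

C2-exponent : ∀ j d → j *ℕ j +ℕ d C 2 +ℕ j *ℕ d ≡ (j +ℕ d) C 2 +ℕ suc j C 2
C2-exponent j d = begin
  j *ℕ j +ℕ d C 2 +ℕ j *ℕ d                      ≡⟨ cong (λ t → t +ℕ d C 2 +ℕ j *ℕ d) (C2-double j) ⟨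
  j C 2 +ℕ j C 2 +ℕ j +ℕ d C 2 +ℕ j *ℕ d         ≡⟨ regroup (j C 2) (d C 2) j d ⟩
  j C 2 +ℕ d C 2 +ℕ j *ℕ d +ℕ (j C 2 +ℕ j)      ≡⟨ cong₂ _+ℕ_ (C2-+ j d) (C2-suc j) ⟨
  (j +ℕ d) C 2 +ℕ suc j C 2                      ∎
  where
  regroup : ∀ a b j d → a +ℕ a +ℕ j +ℕ b +ℕ j *ℕ d ≡ a +ℕ b +ℕ j *ℕ d +ℕ (a +ℕ j)
  regroup = ℕ-Solver.solve-∀

m+m≤n⇒m≤n/2 : ∀ {j N} → j +ℕ j ≤ N → j ≤ N divℕ 2
m+m≤n⇒m≤n/2 {j} {N} j+j≤N = ℕ.≤-trans (ℕ.≤-reflexive (sym (m*n/n≡m j 2)))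
                                        (/-monoˡ-≤ 2 (ℕ.≤-trans (ℕ.≤-reflexive (sym (double j))) j+j≤N))
  where
  double : ∀ j → j +ℕ j ≡ j *ℕ 2
  double = ℕ-Solver.solve-∀

m≤n/2⇒m+m≤n : ∀ {j N} → j ≤ N divℕ 2 → j +ℕ j ≤ N
m≤n/2⇒m+m≤n {j} {N} j≤N/2 =
  ℕ.≤-trans (ℕ.≤-reflexive (double j)) (ℕ.≤-trans (ℕ.*-mono-≤ j≤N/2 (ℕ.≤-refl {2})) (m/n*n≤m N 2))
  where
  double : ∀ j → j +ℕ j ≡ j *ℕ 2
  double = ℕ-Solver.solve-∀

^-C2-suc : ∀ x n → x ^ (suc n C 2) ≡ x ^ (n C 2) * x ^ n
^-C2-suc x n = trans (cong (x ^_) (C2-suc n)) (^-distribˡ-+-* x (n C 2) n)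

^-C2-square : ∀ x j d → x ^ (j *ℕ j) * x ^ (d C 2) * x ^ (j *ℕ d) ≡ x ^ ((j +ℕ d) C 2) * x ^ (suc j C 2)
^-C2-square x j d = begin
  x ^ (j *ℕ j) * x ^ (d C 2) * x ^ (j *ℕ d)    ≡⟨ cong (_* x ^ (j *ℕ d)) (^-distribˡ-+-* x (j *ℕ j) (d C 2)) ⟨
  x ^ (j *ℕ j +ℕ d C 2) * x ^ (j *ℕ d)         ≡⟨ ^-distribˡ-+-* x (j *ℕ j +ℕ d C 2) (j *ℕ d) ⟨
  x ^ (j *ℕ j +ℕ d C 2 +ℕ j *ℕ d)              ≡⟨ cong (x ^_) (C2-exponent j d) ⟩
  x ^ ((j +ℕ d) C 2 +ℕ suc j C 2)              ≡⟨ ^-distribˡ-+-* x ((j +ℕ d) C 2) (suc j C 2) ⟩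
  x ^ ((j +ℕ d) C 2) * x ^ (suc j C 2)         ∎

sumTo-cong : ∀ n {f g : ℕ → ℚ} → (∀ i → i ≤ n → f i ≡ g i) → sumTo n f ≡ sumTo n g
sumTo-cong zero    f≗g = f≗g 0 z≤n
sumTo-cong (suc n) f≗g =
  cong₂ _+_ (sumTo-cong n (λ i i≤n → f≗g i (ℕ.m≤n⇒m≤1+n i≤n))) (f≗g (suc n) ℕ.≤-refl)

sumTo-+ : ∀ n (f g : ℕ → ℚ) → sumTo n (λ i → f i + g i) ≡ sumTo n f + sumTo n g
sumTo-+ zero    f g = refl
sumTo-+ (suc n) f g = begin
  sumTo n (λ i → f i + g i) + (f (suc n) + g (suc n))
    ≡⟨ cong (_+ (f (suc n) + g (suc n))) (sumTo-+ n f g) ⟩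
  sumTo n f + sumTo n g + (f (suc n) + g (suc n))
    ≡⟨ interchange (sumTo n f) (sumTo n g) (f (suc n)) (g (suc n)) ⟩
  sumTo n f + f (suc n) + (sumTo n g + g (suc n))
    ∎
  where
  interchange : ∀ a b c d → a + b + (c + d) ≡ a + c + (b + d)
  interchange = solve-∀ ring

sumTo-*ˡ : ∀ n a (f : ℕ → ℚ) → sumTo n (λ i → a * f i) ≡ a * sumTo n f
sumTo-*ˡ zero    a f = refl
sumTo-*ˡ (suc n) a f = begin
  sumTo n (λ i → a * f i) + a * f (suc n)   ≡⟨ cong (_+ a * f (suc n)) (sumTo-*ˡ n a f) ⟩
  a * sumTo n f + a * f (suc n)             ≡⟨ *-distribˡ-+ a (sumTo n f) (f (suc n)) ⟨
  a * (sumTo n f + f (suc n))               ∎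

sumTo-*ʳ : ∀ n a (f : ℕ → ℚ) → sumTo n (λ i → f i * a) ≡ sumTo n f * a
sumTo-*ʳ n a f = begin
  sumTo n (λ i → f i * a)    ≡⟨ sumTo-cong n (λ i _ → *-comm (f i) a) ⟩
  sumTo n (λ i → a * f i)    ≡⟨ sumTo-*ˡ n a f ⟩
  a * sumTo n f              ≡⟨ *-comm a (sumTo n f) ⟩
  sumTo n f * a              ∎

sumTo-minus : ∀ n (f g : ℕ → ℚ) → sumTo n (λ i → f i - g i) ≡ sumTo n f - sumTo n g
sumTo-minus zero    f g = refl
sumTo-minus (suc n) f g = begin
  sumTo n (λ i → f i - g i) + (f (suc n) - g (suc n))
    ≡⟨ cong (_+ (f (suc n) - g (suc n))) (sumTo-minus n f g) ⟩
  sumTo n f - sumTo n g + (f (suc n) - g (suc n))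
    ≡⟨ interchange (sumTo n f) (sumTo n g) (f (suc n)) (g (suc n)) ⟩
  sumTo n f + f (suc n) - (sumTo n g + g (suc n))
    ∎
  where
  interchange : ∀ a b c d → a - b + (c - d) ≡ a + c - (b + d)
  interchange = solve-∀ ring

sumTo-suc : ∀ n (f : ℕ → ℚ) → sumTo (suc n) f ≡ f 0 + sumTo n (λ i → f (suc i))
sumTo-suc zero    f = refl
sumTo-suc (suc n) f = begin
  sumTo (suc n) f + f (suc (suc n))                          ≡⟨ cong (_+ f (suc (suc n))) (sumTo-suc n f) ⟩
  f 0 + sumTo n (λ i → f (suc i)) + f (suc (suc n))          ≡⟨ +-assoc (f 0) _ _ ⟩
  f 0 + (sumTo n (λ i → f (suc i)) + f (suc (suc n)))        ∎

sumTo-telescope : ∀ n (G : ℕ → ℚ) → sumTo n (λ i → G (suc i) - G i) ≡ G (suc n) - G 0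
sumTo-telescope zero    G = refl
sumTo-telescope (suc n) G = begin
  sumTo n (λ i → G (suc i) - G i) + (G (suc (suc n)) - G (suc n))
    ≡⟨ cong (_+ (G (suc (suc n)) - G (suc n))) (sumTo-telescope n G) ⟩
  G (suc n) - G 0 + (G (suc (suc n)) - G (suc n))
    ≡⟨ collapse (G 0) (G (suc n)) (G (suc (suc n))) ⟩
  G (suc (suc n)) - G 0
    ∎
  where
  collapse : ∀ a b c → b - a + (c - b) ≡ c - a
  collapse = solve-∀ ring

sumTo-extend : ∀ {m n} (f : ℕ → ℚ) → m ≤ n → (∀ i → m < i → i ≤ n → f i ≡ 0ℚ) → sumTo n f ≡ sumTo m f
sumTo-extend {n = zero}      f z≤n   _      = refl
sumTo-extend {m} {n = suc n} f m≤1+n vanish with ℕ.m≤n⇒m<n∨m≡n m≤1+n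
... | inj₂ refl          = refl
... | inj₁ (s≤s m≤n) = begin
  sumTo n f + f (suc n)  ≡⟨ cong₂ _+_ (sumTo-extend f m≤n (λ i m<i i≤n → vanish i m<i (ℕ.m≤n⇒m≤1+n i≤n)))
                                      (vanish (suc n) (s≤s m≤n) ℕ.≤-refl) ⟩
  sumTo m f + 0ℚ
    ≡⟨ +-identityʳ (sumTo m f) ⟩
  sumTo m f
    ∎

sumTo-triangle : ∀ N (f : ℕ → ℕ → ℚ) →
  sumTo N (λ j → sumTo (N ∸ℕ j) (f j)) ≡ sumTo N (λ m → sumTo m (λ j → f j (m ∸ℕ j)))
sumTo-triangle zero    f = refl
sumTo-triangle (suc N) f = begin
  sumTo N (λ j → sumTo (suc N ∸ℕ j) (f j)) + sumTo (N ∸ℕ N) (f (suc N))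
    ≡⟨ cong₂ _+_ (sumTo-cong N (λ j j≤N → cong (λ t → sumTo t (f j)) (ℕ.+-∸-assoc 1 j≤N)))
                 (cong (λ t → sumTo t (f (suc N))) (ℕ.n∸n≡0 N)) ⟩
  sumTo N (λ j → sumTo (N ∸ℕ j) (f j) + f j (suc (N ∸ℕ j))) + f (suc N) 0
    ≡⟨ cong (_+ f (suc N) 0) (sumTo-+ N (λ j → sumTo (N ∸ℕ j) (f j)) (λ j → f j (suc (N ∸ℕ j)))) ⟩
  sumTo N (λ j → sumTo (N ∸ℕ j) (f j)) + sumTo N (λ j → f j (suc (N ∸ℕ j))) + f (suc N) 0
    ≡⟨ +-assoc (sumTo N (λ j → sumTo (N ∸ℕ j) (f j))) (sumTo N (λ j → f j (suc (N ∸ℕ j)))) (f (suc N) 0) ⟩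
  sumTo N (λ j → sumTo (N ∸ℕ j) (f j)) + (sumTo N (λ j → f j (suc (N ∸ℕ j))) + f (suc N) 0)
    ≡⟨ cong₂ _+_ (sumTo-triangle N f)
                 (cong₂ _+_ (sumTo-cong N (λ j j≤N → cong (f j) (sym (ℕ.+-∸-assoc 1 j≤N))))
                            (cong (f (suc N)) (sym (ℕ.n∸n≡0 N)))) ⟩
  sumTo N (λ m → sumTo m (λ j → f j (m ∸ℕ j))) + sumTo (suc N) (λ j → f j (suc N ∸ℕ j))
    ∎

module QBinomial (q : ℚ) where

  poch-+ : ∀ a m n → poch a q (m +ℕ n) ≡ poch a q m * poch (a * q ^ m) q n
  poch-+ a m zero    = trans (cong (poch a q) (ℕ.+-identityʳ m)) (sym (*-identityʳ (poch a q m)))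
  poch-+ a m (suc n) = begin
    poch a q (m +ℕ suc n)
      ≡⟨ cong (poch a q) (ℕ.+-suc m n) ⟩
    poch a q (m +ℕ n) * (1ℚ - a * q ^ (m +ℕ n))
      ≡⟨ cong₂ (λ u v → u * (1ℚ - a * v)) (poch-+ a m n) (^-distribˡ-+-* q m n) ⟩
    poch a q m * poch (a * q ^ m) q n * (1ℚ - a * (q ^ m * q ^ n))
      ≡⟨ regroup (poch a q m) (poch (a * q ^ m) q n) a (q ^ m) (q ^ n) ⟩
    poch a q m * (poch (a * q ^ m) q n * (1ℚ - a * q ^ m * q ^ n))
      ∎
    where
    regroup : ∀ u v a x y → u * v * (1ℚ - a * (x * y)) ≡ u * (v * (1ℚ - a * x * y))
    regroup = solve-∀ ring

  poch-≢0 : ∀ {a N n} → poch a q N ≢ 0ℚ → n ≤ N → poch a q n ≢ 0ℚ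
  poch-≢0 {a} {N} {n} pochN≢0 n≤N = x*y≢0⇒x≢0 (λ prefix≡0 → pochN≢0 (begin
    poch a q N                                          ≡⟨ cong (poch a q) (ℕ.m+[n∸m]≡n n≤N) ⟨
    poch a q (n +ℕ (N ∸ℕ n))                            ≡⟨ poch-+ a n (N ∸ℕ n) ⟩
    poch a q n * poch (a * q ^ n) q (N ∸ℕ n)            ≡⟨ prefix≡0 ⟩
    0ℚ                                                  ∎))

  poch-shift : ∀ a n → poch a q n * (1ℚ - a * q ^ n) ≡ (1ℚ - a) * poch (a * q) q n
  poch-shift a zero    = shift-base a
    where
    shift-base : ∀ a → 1ℚ * (1ℚ - a * 1ℚ) ≡ (1ℚ - a) * 1ℚ
    shift-base = solve-∀ ring
  poch-shift a (suc n) = begin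
    poch a q n * (1ℚ - a * q ^ n) * (1ℚ - a * (q ^ n * q))
      ≡⟨ cong (_* (1ℚ - a * (q ^ n * q))) (poch-shift a n) ⟩
    (1ℚ - a) * poch (a * q) q n * (1ℚ - a * (q ^ n * q))
      ≡⟨ regroup (1ℚ - a) (poch (a * q) q n) a q (q ^ n) ⟩
    (1ℚ - a) * (poch (a * q) q n * (1ℚ - a * q * q ^ n))
      ∎
    where
    regroup : ∀ u v a q x → u * v * (1ℚ - a * (x * q)) ≡ u * (v * (1ℚ - a * q * x))
    regroup = solve-∀ ring

  qbinom : ℕ → ℕ → ℚ
  qbinom n       zero    = 1ℚ
  qbinom zero    (suc k) = 0ℚ
  qbinom (suc n) (suc k) = qbinom n k + q ^ suc k * qbinom n (suc k)

  qbinom-≡0 : ∀ {n k} → n < k → qbinom n k ≡ 0ℚ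
  qbinom-≡0 {zero}  {suc k} _         = refl
  qbinom-≡0 {suc n} {suc k} (s≤s n<k) = begin
    qbinom n k + q ^ suc k * qbinom n (suc k)
      ≡⟨ cong₂ (λ u v → u + q ^ suc k * v) (qbinom-≡0 n<k) (qbinom-≡0 (ℕ.m≤n⇒m≤1+n n<k)) ⟩
    0ℚ + q ^ suc k * 0ℚ
      ≡⟨ vanish (q ^ suc k) ⟩
    0ℚ
      ∎
    where
    vanish : ∀ x → 0ℚ + x * 0ℚ ≡ 0ℚ
    vanish = solve-∀ ring

  -- Multipliers of [n k] need only agree when k ≤ n; this absorbs the boundary cases of
  -- truncated subtraction in the indices.
  qbinom-*-cong : ∀ n k {x y} → (k ≤ n → x ≡ y) → x * qbinom n k ≡ y * qbinom n k
  qbinom-*-cong n k {x} {y} x≡y with k ℕ.≤? n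
  ... | yes k≤n = cong (_* qbinom n k) (x≡y k≤n)
  ... | no  k≰n = begin
    x * qbinom n k  ≡⟨ cong (x *_) (qbinom-≡0 (ℕ.≰⇒> k≰n)) ⟩
    x * 0ℚ          ≡⟨ *-zeroʳ x ⟩
    0ℚ              ≡⟨ *-zeroʳ y ⟨
    y * 0ℚ          ≡⟨ cong (y *_) (qbinom-≡0 (ℕ.≰⇒> k≰n)) ⟨
    y * qbinom n k  ∎

  qbinom-pascal′ : ∀ n k → qbinom (suc n) (suc k) ≡ q ^ (n ∸ℕ k) * qbinom n k + qbinom n (suc k)
  qbinom-pascal′ zero    zero    = base (q ^ 1)
    where
    base : ∀ x → 1ℚ + x * 0ℚ ≡ 1ℚ * 1ℚ + 0ℚ
    base = solve-∀ ring
  qbinom-pascal′ zero    (suc k) = base (q ^ suc (suc k))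
    where
    base : ∀ x → 0ℚ + x * 0ℚ ≡ 1ℚ * 0ℚ + 0ℚ
    base = solve-∀ ring
  qbinom-pascal′ (suc n) zero    = begin
    1ℚ + q ^ 1 * qbinom (suc n) 1            ≡⟨ cong (λ t → 1ℚ + q ^ 1 * t) (qbinom-pascal′ n 0) ⟩
    1ℚ + q ^ 1 * (q ^ n * 1ℚ + qbinom n 1)   ≡⟨ regroup q (q ^ n) (qbinom n 1) ⟩
    q ^ n * q * 1ℚ + (1ℚ + q ^ 1 * qbinom n 1) ∎
    where
    regroup : ∀ q x b → 1ℚ + 1ℚ * q * (x * 1ℚ + b) ≡ x * q * 1ℚ + (1ℚ + 1ℚ * q * b)
    regroup = solve-∀ ring
  qbinom-pascal′ (suc n) (suc k) = begin
    qbinom (suc n) (suc k) + y * qbinom (suc n) (suc (suc k))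
      ≡⟨ cong₂ (λ u v → u + y * v) (qbinom-pascal′ n k) (qbinom-pascal′ n (suc k)) ⟩
    (a * b₀ + b₁) + y * (a′ * b₁ + b₂)
      ≡⟨ regroup₁ a b₀ b₁ y a′ b₂ ⟩
    (a * b₀ + b₁ + y * b₂) + y * a′ * b₁
      ≡⟨ cong ((a * b₀ + b₁ + y * b₂) +_) (qbinom-*-cong n (suc k) exponent) ⟩
    (a * b₀ + b₁ + y * b₂) + a * x * b₁
      ≡⟨ regroup₂ a b₀ b₁ y b₂ x ⟩
    a * (b₀ + x * b₁) + (b₁ + y * b₂)
      ∎
    where
    x y a a′ b₀ b₁ b₂ : ℚ
    x = q ^ suc k
    y = q ^ suc (suc k)
    a = q ^ (n ∸ℕ k)
    a′ = q ^ (n ∸ℕ suc k)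
    b₀ = qbinom n k
    b₁ = qbinom n (suc k)
    b₂ = qbinom n (suc (suc k))
    exponent : suc k ≤ n → y * a′ ≡ a * x
    exponent k<n = begin
      y * a′                          ≡⟨ ^-distribˡ-+-* q (suc (suc k)) (n ∸ℕ suc k) ⟨
      q ^ suc (suc k +ℕ (n ∸ℕ suc k)) ≡⟨ cong (λ e → q ^ suc e) (ℕ.m+[n∸m]≡n k<n) ⟩
      q ^ suc n                       ≡⟨ cong (λ e → q ^ suc e) (ℕ.m∸n+n≡m (ℕ.<⇒≤ k<n)) ⟨
      q ^ suc (n ∸ℕ k +ℕ k)           ≡⟨ cong (q ^_) (ℕ.+-suc (n ∸ℕ k) k) ⟨
      q ^ (n ∸ℕ k +ℕ suc k)           ≡⟨ ^-distribˡ-+-* q (n ∸ℕ k) (suc k) ⟩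
      a * x                           ∎
    regroup₁ : ∀ a b₀ b₁ y a′ b₂ →
      (a * b₀ + b₁) + y * (a′ * b₁ + b₂) ≡ (a * b₀ + b₁ + y * b₂) + y * a′ * b₁
    regroup₁ = solve-∀ ring
    regroup₂ : ∀ a b₀ b₁ y b₂ x →
      (a * b₀ + b₁ + y * b₂) + a * x * b₁ ≡ a * (b₀ + x * b₁) + (b₁ + y * b₂)
    regroup₂ = solve-∀ ring

  qbinom-ratio : ∀ n k → (1ℚ - q ^ suc k) * qbinom n (suc k) ≡ (1ℚ - q ^ (n ∸ℕ k)) * qbinom n k
  qbinom-ratio n k = begin
    (1ℚ - x) * b₁                ≡⟨ expand b₀ b₁ x ⟩
    (b₀ + b₁) - (b₀ + x * b₁)    ≡⟨ cong (λ t → (b₀ + b₁) - t) (qbinom-pascal′ n k) ⟩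
    (b₀ + b₁) - (a * b₀ + b₁)    ≡⟨ collapse b₀ b₁ a ⟩
    (1ℚ - a) * b₀                ∎
    where
    x a b₀ b₁ : ℚ
    x = q ^ suc k
    a = q ^ (n ∸ℕ k)
    b₀ = qbinom n k
    b₁ = qbinom n (suc k)
    expand : ∀ b₀ b₁ x → (1ℚ - x) * b₁ ≡ (b₀ + b₁) - (b₀ + x * b₁)
    expand = solve-∀ ring
    collapse : ∀ b₀ b₁ a → (b₀ + b₁) - (a * b₀ + b₁) ≡ (1ℚ - a) * b₀
    collapse = solve-∀ ring

  qbinom-ratio′ : ∀ n k {a b} → (k ≤ n → a +ℕ (n ∸ℕ k) ≡ b) →
    q ^ a * (1ℚ - q ^ suc k) * qbinom n (suc k) ≡ (q ^ a - q ^ b) * qbinom n k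
  qbinom-ratio′ n k {a} {b} a+[n∸k]≡b = begin
    q ^ a * (1ℚ - q ^ suc k) * qbinom n (suc k)
      ≡⟨ *-assoc (q ^ a) _ _ ⟩
    q ^ a * ((1ℚ - q ^ suc k) * qbinom n (suc k))
      ≡⟨ cong (q ^ a *_) (qbinom-ratio n k) ⟩
    q ^ a * ((1ℚ - q ^ (n ∸ℕ k)) * qbinom n k)
      ≡⟨ distrib (q ^ a) (q ^ (n ∸ℕ k)) (qbinom n k) ⟩
    (q ^ a - q ^ a * q ^ (n ∸ℕ k)) * qbinom n k
      ≡⟨ qbinom-*-cong n k (λ k≤n → cong (λ t → q ^ a - t) (exponent k≤n)) ⟩
    (q ^ a - q ^ b) * qbinom n k
      ∎
    where
    exponent : k ≤ n → q ^ a * q ^ (n ∸ℕ k) ≡ q ^ b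
    exponent k≤n = trans (sym (^-distribˡ-+-* q a (n ∸ℕ k))) (cong (q ^_) (a+[n∸k]≡b k≤n))
    distrib : ∀ x y b → x * ((1ℚ - y) * b) ≡ (x - x * y) * b
    distrib = solve-∀ ring

  qbinom-poch : ∀ k {n d} → k +ℕ d ≡ n → qbinom n k * (poch q q k * poch q q d) ≡ poch q q n
  qbinom-poch zero            refl        = trans (*-identityˡ _) (*-identityˡ _)
  qbinom-poch (suc k) {n} {d} 1+k+d≡n = begin
    qbinom n (suc k) * (poch q q k * (1ℚ - q * q ^ k) * poch q q d)
      ≡⟨ regroup₁ (qbinom n (suc k)) (poch q q k) (poch q q d) q (q ^ k) ⟩
    (1ℚ - q ^ suc k) * qbinom n (suc k) * (poch q q k * poch q q d)
      ≡⟨ cong (_* (poch q q k * poch q q d)) (qbinom-ratio n k) ⟩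
    (1ℚ - q ^ (n ∸ℕ k)) * qbinom n k * (poch q q k * poch q q d)
      ≡⟨ cong (λ e → (1ℚ - q ^ e) * qbinom n k * (poch q q k * poch q q d)) n∸k≡1+d ⟩
    (1ℚ - q ^ d * q) * qbinom n k * (poch q q k * poch q q d)
      ≡⟨ regroup₂ (qbinom n k) (poch q q k) (poch q q d) q (q ^ d) ⟩
    qbinom n k * (poch q q k * poch q q (suc d))
      ≡⟨ qbinom-poch k k+[1+d]≡n ⟩
    poch q q n
      ∎
    where
    k+[1+d]≡n : k +ℕ suc d ≡ n
    k+[1+d]≡n = trans (ℕ.+-suc k d) 1+k+d≡n
    n∸k≡1+d : n ∸ℕ k ≡ suc d
    n∸k≡1+d = trans (cong (_∸ℕ k) (sym k+[1+d]≡n)) (ℕ.m+n∸m≡n k (suc d))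
    regroup₁ : ∀ b p r q x → b * (p * (1ℚ - q * x) * r) ≡ (1ℚ - x * q) * b * (p * r)
    regroup₁ = solve-∀ ring
    regroup₂ : ∀ b p r q x → (1ℚ - x * q) * b * (p * r) ≡ b * (p * (r * (1ℚ - q * x)))
    regroup₂ = solve-∀ ring

  qbinom-revision-≤ : ∀ {n m j} → poch q q n ≢ 0ℚ → j ≤ m → m ≤ n →
    qbinom n m * qbinom m j ≡ qbinom n j * qbinom (n ∸ℕ j) (m ∸ℕ j)
  qbinom-revision-≤ {n} {m} {j} pochn≢0 j≤m m≤n = *-cancelʳ-≡ denominator≢0 (begin
    qbinom n m * qbinom m j * (pj * pm∸j * pn∸m)
      ≡⟨ regroup₁ (qbinom n m) (qbinom m j) pj pm∸j pn∸m ⟩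
    qbinom n m * (qbinom m j * (pj * pm∸j) * pn∸m)
      ≡⟨ cong (λ t → qbinom n m * (t * pn∸m)) (qbinom-poch j (ℕ.m+[n∸m]≡n j≤m)) ⟩
    qbinom n m * (poch q q m * pn∸m)
      ≡⟨ qbinom-poch m (ℕ.m+[n∸m]≡n m≤n) ⟩
    poch q q n
      ≡⟨ qbinom-poch j (ℕ.m+[n∸m]≡n j≤n) ⟨
    qbinom n j * (pj * poch q q (n ∸ℕ j))
      ≡⟨ cong (λ t → qbinom n j * (pj * t)) (qbinom-poch (m ∸ℕ j) [m∸j]+[n∸m]≡n∸j) ⟨
    qbinom n j * (pj * (qbinom (n ∸ℕ j) (m ∸ℕ j) * (pm∸j * pn∸m)))
      ≡⟨ regroup₂ (qbinom n j) (qbinom (n ∸ℕ j) (m ∸ℕ j)) pj pm∸j pn∸m ⟩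
    qbinom n j * qbinom (n ∸ℕ j) (m ∸ℕ j) * (pj * pm∸j * pn∸m)
      ∎)
    where
    j≤n : j ≤ n
    j≤n = ℕ.≤-trans j≤m m≤n
    pj pm∸j pn∸m : ℚ
    pj = poch q q j
    pm∸j = poch q q (m ∸ℕ j)
    pn∸m = poch q q (n ∸ℕ m)
    denominator≢0 : pj * pm∸j * pn∸m ≢ 0ℚ
    denominator≢0 = x*y≢0 (x*y≢0 (poch-≢0 pochn≢0 j≤n) (poch-≢0 pochn≢0 (ℕ.≤-trans (ℕ.m∸n≤m m j) m≤n)))
                          (poch-≢0 pochn≢0 (ℕ.m∸n≤m n m))
    [m∸j]+[n∸m]≡n∸j : m ∸ℕ j +ℕ (n ∸ℕ m) ≡ n ∸ℕ j
    [m∸j]+[n∸m]≡n∸j = begin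
      m ∸ℕ j +ℕ (n ∸ℕ m)    ≡⟨ ℕ.+-comm (m ∸ℕ j) (n ∸ℕ m) ⟩
      n ∸ℕ m +ℕ (m ∸ℕ j)    ≡⟨ ℕ.+-∸-assoc (n ∸ℕ m) j≤m ⟨
      n ∸ℕ m +ℕ m ∸ℕ j      ≡⟨ cong (_∸ℕ j) (ℕ.m∸n+n≡m m≤n) ⟩
      n ∸ℕ j                ∎
    regroup₁ : ∀ a b x y z → a * b * (x * y * z) ≡ a * (b * (x * y) * z)
    regroup₁ = solve-∀ ring
    regroup₂ : ∀ a b x y z → a * (x * (b * (y * z))) ≡ a * b * (x * y * z)
    regroup₂ = solve-∀ ring

  qbinom-revision : ∀ {n m j} → poch q q n ≢ 0ℚ → j ≤ m →
    qbinom n m * qbinom m j ≡ qbinom n j * qbinom (n ∸ℕ j) (m ∸ℕ j)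
  qbinom-revision {n} {m} {j} pochn≢0 j≤m with m ℕ.≤? n
  ... | yes m≤n = qbinom-revision-≤ pochn≢0 j≤m m≤n
  ... | no  m≰n = begin
    qbinom n m * qbinom m j                  ≡⟨ cong (_* qbinom m j) (qbinom-≡0 n<m) ⟩
    0ℚ * qbinom m j                          ≡⟨ *-zeroˡ (qbinom m j) ⟩
    0ℚ                                       ≡⟨ rhs≡0 ⟨
    qbinom n j * qbinom (n ∸ℕ j) (m ∸ℕ j)    ∎
    where
    n<m : n < m
    n<m = ℕ.≰⇒> m≰n
    rhs≡0 : qbinom n j * qbinom (n ∸ℕ j) (m ∸ℕ j) ≡ 0ℚ
    rhs≡0 with j ℕ.≤? n
    ... | yes j≤n = trans (cong (qbinom n j *_) (qbinom-≡0 (ℕ.∸-monoˡ-< n<m j≤n))) (*-zeroʳ (qbinom n j))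
    ... | no  j≰n = trans (cong (_* qbinom (n ∸ℕ j) (m ∸ℕ j)) (qbinom-≡0 (ℕ.≰⇒> j≰n)))
                          (*-zeroˡ (qbinom (n ∸ℕ j) (m ∸ℕ j)))

  homPoch : ℚ → ℚ → ℕ → ℚ
  homPoch y x zero    = 1ℚ
  homPoch y x (suc n) = homPoch y x n * (y - x * q ^ n)

  poch≡homPoch : ∀ x n → poch x q n ≡ homPoch 1ℚ x n
  poch≡homPoch x zero    = refl
  poch≡homPoch x (suc n) = cong (_* (1ℚ - x * q ^ n)) (poch≡homPoch x n)

  homPoch-≡0 : ∀ x {i n} → i < n → homPoch (x * q ^ i) x n ≡ 0ℚ
  homPoch-≡0 x {i} {suc n} (s≤s i≤n) with ℕ.m≤n⇒m<n∨m≡n i≤n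
  ... | inj₁ i<n  = trans (cong (_* (x * q ^ i - x * q ^ n)) (homPoch-≡0 x i<n)) (*-zeroˡ (x * q ^ i - x * q ^ n))
  ... | inj₂ refl = vanish (homPoch (x * q ^ i) x i) (x * q ^ i)
    where
    vanish : ∀ h y → h * (y - y) ≡ 0ℚ
    vanish = solve-∀ ring

  homTerm : ℚ → ℚ → ℕ → ℕ → ℚ
  homTerm x y n i = qbinom n i * sgn i * q ^ (i C 2) * x ^ i * y ^ (n ∸ℕ i)

  homTerm-pascal : ∀ x y {n i} → i ≤ n →
    homTerm x y (suc n) (suc i) ≡ y * homTerm x y n (suc i) - x * q ^ n * homTerm x y n i
  homTerm-pascal x y {n} {i} i≤n = begin
    qbinom (suc n) (suc i) * (s * - 1ℚ) * q ^ (suc i C 2) * (X * x) * Y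
      ≡⟨ cong₂ (λ b c → b * (s * - 1ℚ) * c * (X * x) * Y) (qbinom-pascal′ n i) (^-C2-suc q i) ⟩
    (a * b₀ + b₁) * (s * - 1ℚ) * (K * I) * (X * x) * Y
      ≡⟨ expand a b₀ b₁ s K I X x Y ⟩
    (s * - 1ℚ) * (K * I) * (X * x) * (Y * b₁) - x * (a * I) * (b₀ * s * K * X * Y)
      ≡⟨ cong₂ (λ u v → (s * - 1ℚ) * (K * I) * (X * x) * u - x * v * (b₀ * s * K * X * Y)) Y-shift aI≡qⁿ ⟩
    (s * - 1ℚ) * (K * I) * (X * x) * (Y′ * y * b₁) - x * q ^ n * (b₀ * s * K * X * Y)
      ≡⟨ cong (λ t → t - x * q ^ n * (b₀ * s * K * X * Y)) (regroup s K I X x Y′ y b₁) ⟩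
    y * (b₁ * (s * - 1ℚ) * (K * I) * (X * x) * Y′) - x * q ^ n * (b₀ * s * K * X * Y)
      ≡⟨ cong (λ c → y * (b₁ * (s * - 1ℚ) * c * (X * x) * Y′) - x * q ^ n * (b₀ * s * K * X * Y)) (^-C2-suc q i) ⟨
    y * homTerm x y n (suc i) - x * q ^ n * homTerm x y n i
      ∎
    where
    s a b₀ b₁ K I X Y Y′ : ℚ
    s = sgn i
    a = q ^ (n ∸ℕ i)
    b₀ = qbinom n i
    b₁ = qbinom n (suc i)
    K = q ^ (i C 2)
    I = q ^ i
    X = x ^ i
    Y = y ^ (n ∸ℕ i)
    Y′ = y ^ (n ∸ℕ suc i)
    Y-shift : Y * b₁ ≡ Y′ * y * b₁
    Y-shift = qbinom-*-cong n (suc i) (λ i<n → cong (y ^_) (ℕ.+-∸-assoc 1 i<n))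
    aI≡qⁿ : a * I ≡ q ^ n
    aI≡qⁿ = trans (sym (^-distribˡ-+-* q (n ∸ℕ i) i)) (cong (q ^_) (ℕ.m∸n+n≡m i≤n))
    expand : ∀ a b₀ b₁ s K I X x Y →
      (a * b₀ + b₁) * (s * - 1ℚ) * (K * I) * (X * x) * Y
        ≡ (s * - 1ℚ) * (K * I) * (X * x) * (Y * b₁) - x * (a * I) * (b₀ * s * K * X * Y)
    expand = solve-∀ ring
    regroup : ∀ s K I X x Y′ y b₁ →
      (s * - 1ℚ) * (K * I) * (X * x) * (Y′ * y * b₁) ≡ y * (b₁ * (s * - 1ℚ) * (K * I) * (X * x) * Y′)
    regroup = solve-∀ ring

  homSum-peel : ∀ x y n → sumTo n (homTerm x y n) ≡ homTerm x y n 0 + sumTo n (λ i → homTerm x y n (suc i))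
  homSum-peel x y n = begin
    sumTo n (homTerm x y n)                          ≡⟨ +-identityʳ _ ⟨
    sumTo n (homTerm x y n) + 0ℚ                     ≡⟨ cong (sumTo n (homTerm x y n) +_) last≡0 ⟨
    sumTo (suc n) (homTerm x y n)                    ≡⟨ sumTo-suc n (homTerm x y n) ⟩
    homTerm x y n 0 + sumTo n (λ i → homTerm x y n (suc i)) ∎
    where
    last≡0 : homTerm x y n (suc n) ≡ 0ℚ
    last≡0 = trans (cong (λ b → b * sgn (suc n) * q ^ (suc n C 2) * x ^ suc n * y ^ (n ∸ℕ suc n))
                         (qbinom-≡0 {n} ℕ.≤-refl))
                   (zero-factor (sgn (suc n)) (q ^ (suc n C 2)) (x ^ suc n) (y ^ (n ∸ℕ suc n)))
      where
      zero-factor : ∀ s c u v → 0ℚ * s * c * u * v ≡ 0ℚ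
      zero-factor = solve-∀ ring

  q-binomial : ∀ x y n →
    homPoch y x n ≡ sumTo n (λ i → qbinom n i * sgn i * q ^ (i C 2) * x ^ i * y ^ (n ∸ℕ i))
  q-binomial x y zero    = sym (*-identityˡ (1ℚ * 1ℚ * 1ℚ * 1ℚ))
  q-binomial x y (suc n) = sym (begin
    sumTo (suc n) (term (suc n))
      ≡⟨ sumTo-suc n (term (suc n)) ⟩
    term (suc n) 0 + sumTo n (λ i → term (suc n) (suc i))
      ≡⟨ cong (term (suc n) 0 +_) (sumTo-cong n (λ i → homTerm-pascal x y)) ⟩
    term (suc n) 0 + sumTo n (λ i → y * term n (suc i) - z * term n i)
      ≡⟨ cong (term (suc n) 0 +_) (sumTo-minus n _ _) ⟩
    term (suc n) 0 + (sumTo n (λ i → y * term n (suc i)) - sumTo n (λ i → z * term n i))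
      ≡⟨ cong₂ (λ u v → term (suc n) 0 + (u - v)) (sumTo-*ˡ n y (λ i → term n (suc i))) (sumTo-*ˡ n z (term n)) ⟩
    term (suc n) 0 + (y * S⁺ - z * S)
      ≡⟨ cong (λ s → term (suc n) 0 + (y * S⁺ - z * s)) (homSum-peel x y n) ⟩
    term (suc n) 0 + (y * S⁺ - z * (term n 0 + S⁺))
      ≡⟨ collect (y ^ n) S⁺ y z ⟩
    (term n 0 + S⁺) * (y - z)
      ≡⟨ cong (_* (y - z)) (homSum-peel x y n) ⟨
    S * (y - z)
      ≡⟨ cong (_* (y - z)) (q-binomial x y n) ⟨
    homPoch y x (suc n)
      ∎)
    where
    term : ℕ → ℕ → ℚ
    term = homTerm x y
    z S S⁺ : ℚ
    z = x * q ^ n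
    S = sumTo n (term n)
    S⁺ = sumTo n (λ i → term n (suc i))
    collect : ∀ Y S⁺ y z → 1ℚ * 1ℚ * 1ℚ * 1ℚ * (Y * y) + (y * S⁺ - z * (1ℚ * 1ℚ * 1ℚ * 1ℚ * Y + S⁺))
                          ≡ (1ℚ * 1ℚ * 1ℚ * 1ℚ * Y + S⁺) * (y - z)
    collect = solve-∀ ring

  q-binomial-theorem : ∀ x n → poch x q n ≡ sumTo n (λ i → qbinom n i * sgn i * q ^ (i C 2) * x ^ i)
  q-binomial-theorem x n = begin
    poch x q n                                                                    ≡⟨ poch≡homPoch x n ⟩
    homPoch 1ℚ x n                                                                ≡⟨ q-binomial x 1ℚ n ⟩
    sumTo n (λ i → qbinom n i * sgn i * q ^ (i C 2) * x ^ i * 1ℚ ^ (n ∸ℕ i))      ≡⟨ sumTo-cong n drop-unit ⟩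
    sumTo n (λ i → qbinom n i * sgn i * q ^ (i C 2) * x ^ i)                      ∎
    where
    drop-unit : ∀ i → i ≤ n → qbinom n i * sgn i * q ^ (i C 2) * x ^ i * 1ℚ ^ (n ∸ℕ i)
      ≡ qbinom n i * sgn i * q ^ (i C 2) * x ^ i
    drop-unit i _ = trans (cong (qbinom n i * sgn i * q ^ (i C 2) * x ^ i *_) (^-zeroˡ (n ∸ℕ i))) (*-identityʳ _)

module InnerSum (q b : ℚ) where

  open QBinomial q

  innerTerm : ℕ → ℕ → ℕ → ℕ → ℚ
  innerTerm M t j k = qbinom M k * sgn k * q ^ (k C 2) * q ^ k * (q ^ t) ^ (M ∸ℕ k) * poch (b * q ^ (M ∸ℕ k)) q j

  innerSum : ℕ → ℕ → ℕ → ℚ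
  innerSum M t j = sumTo M (innerTerm M t j)

  innerSum-suc : ∀ M t j → innerSum M t (suc j) ≡ innerSum M t j - b * q ^ j * innerSum M (suc t) j
  innerSum-suc M t j = begin
    sumTo M (innerTerm M t (suc j))
      ≡⟨ sumTo-cong M (λ k _ → step k) ⟩
    sumTo M (λ k → innerTerm M t j k - b * q ^ j * innerTerm M (suc t) j k)
      ≡⟨ sumTo-minus M _ _ ⟩
    innerSum M t j - sumTo M (λ k → b * q ^ j * innerTerm M (suc t) j k)
      ≡⟨ cong (λ u → innerSum M t j - u) (sumTo-*ˡ M (b * q ^ j) _) ⟩
    innerSum M t j - b * q ^ j * innerSum M (suc t) j
      ∎
    where
    step : ∀ k → innerTerm M t (suc j) k ≡ innerTerm M t j k - b * q ^ j * innerTerm M (suc t) j k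
    step k = begin
      B * Y * (P * (1ℚ - b * w * q ^ j))
        ≡⟨ expand B Y P b w (q ^ j) ⟩
      B * Y * P - b * q ^ j * (B * (Y * w) * P)
        ≡⟨ cong (λ u → B * Y * P - b * q ^ j * (B * u * P)) (^-distribʳ-* (q ^ t) q (M ∸ℕ k)) ⟨
      B * Y * P - b * q ^ j * (B * (q ^ t * q) ^ (M ∸ℕ k) * P)
        ∎
      where
      B Y w P : ℚ
      B = qbinom M k * sgn k * q ^ (k C 2) * q ^ k
      Y = (q ^ t) ^ (M ∸ℕ k)
      w = q ^ (M ∸ℕ k)
      P = poch (b * w) q j
      expand : ∀ B Y P b w x → B * Y * (P * (1ℚ - b * w * x)) ≡ B * Y * P - b * x * (B * (Y * w) * P)
      expand = solve-∀ ring

  innerSum-eval : ∀ j {M t} → t +ℕ j ≤ M → innerSum M t j ≡ homPoch (q ^ t) q M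
  innerSum-eval zero    {M} {t} _ = begin
    sumTo M (innerTerm M t 0)
      ≡⟨ sumTo-cong M (λ k _ → *-identityʳ _) ⟩
    sumTo M (λ k → qbinom M k * sgn k * q ^ (k C 2) * q ^ k * (q ^ t) ^ (M ∸ℕ k))
      ≡⟨ q-binomial q (q ^ t) M ⟨
    homPoch (q ^ t) q M
      ∎
  innerSum-eval (suc j) {M} {t} t+1+j≤M = begin
    innerSum M t (suc j)
      ≡⟨ innerSum-suc M t j ⟩
    innerSum M t j - b * q ^ j * innerSum M (suc t) j
      ≡⟨ cong₂ (λ u v → u - b * q ^ j * v) (innerSum-eval j t+j≤M) (innerSum-eval j 1+t+j≤M) ⟩
    homPoch (q ^ t) q M - b * q ^ j * homPoch (q ^ t * q) q M
      ≡⟨ cong (λ u → homPoch (q ^ t) q M - b * q ^ j * homPoch u q M) (*-comm (q ^ t) q) ⟩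
    homPoch (q ^ t) q M - b * q ^ j * homPoch (q * q ^ t) q M
      ≡⟨ cong (λ u → homPoch (q ^ t) q M - b * q ^ j * u) (homPoch-≡0 q t<M) ⟩
    homPoch (q ^ t) q M - b * q ^ j * 0ℚ
      ≡⟨ drop (homPoch (q ^ t) q M) (b * q ^ j) ⟩
    homPoch (q ^ t) q M
      ∎
    where
    t+j≤M : t +ℕ j ≤ M
    t+j≤M = ℕ.≤-trans (ℕ.+-mono-≤ (ℕ.≤-refl {t}) (ℕ.n≤1+n j)) t+1+j≤M
    1+t+j≤M : suc t +ℕ j ≤ M
    1+t+j≤M = ℕ.≤-trans (ℕ.≤-reflexive (sym (ℕ.+-suc t j))) t+1+j≤M
    t<M : t < M
    t<M = ℕ.<-≤-trans (ℕ.m<m+n t (s≤s z≤n)) t+1+j≤M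
    drop : ∀ h a → h - a * 0ℚ ≡ h
    drop = solve-∀ ring

  inner-sum : ∀ {M j} → poch q q M ≢ 0ℚ → poch b q M ≢ 0ℚ → j ≤ M →
    sumTo M (λ k → (sgn k * q ^ T k * poch b q (M ∸ℕ k +ℕ j)) ÷' (poch q q (M ∸ℕ k) * poch b q (M ∸ℕ k) * poch q q k))
      ≡ 1ℚ
  inner-sum {M} {j} qM≢0 bM≢0 j≤M = begin
    sumTo M (λ k → (sgn k * q ^ T k * poch b q (M ∸ℕ k +ℕ j)) ÷' (poch q q (M ∸ℕ k) * poch b q (M ∸ℕ k) * poch q q k))
      ≡⟨ sumTo-cong M (λ k k≤M → x*v≡u*y⇒x÷'y≡u÷'v {x = sgn k * q ^ T k * poch b q (M ∸ℕ k +ℕ j)}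
                                                   {u = innerTerm M 0 j k}
                                           (denominator≢0 k≤M) qM≢0 (cross k≤M)) ⟩
    sumTo M (λ k → innerTerm M 0 j k * inv (poch q q M))
      ≡⟨ sumTo-*ʳ M (inv (poch q q M)) (innerTerm M 0 j) ⟩
    innerSum M 0 j * inv (poch q q M)
      ≡⟨ cong (_* inv (poch q q M)) (innerSum-eval j j≤M) ⟩
    homPoch 1ℚ q M * inv (poch q q M)
      ≡⟨ cong (_* inv (poch q q M)) (poch≡homPoch q M) ⟨
    poch q q M * inv (poch q q M)
      ≡⟨ *-invʳ qM≢0 ⟩
    1ℚ
      ∎
    where
    denominator≢0 : ∀ {k} → k ≤ M → poch q q (M ∸ℕ k) * poch b q (M ∸ℕ k) * poch q q k ≢ 0ℚ
    denominator≢0 {k} k≤M =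
      x*y≢0 (x*y≢0 (poch-≢0 qM≢0 (ℕ.m∸n≤m M k)) (poch-≢0 bM≢0 (ℕ.m∸n≤m M k))) (poch-≢0 qM≢0 k≤M)
    cross : ∀ {k} → k ≤ M → sgn k * q ^ T k * poch b q (M ∸ℕ k +ℕ j) * poch q q M
                           ≡ innerTerm M 0 j k * (poch q q (M ∸ℕ k) * poch b q (M ∸ℕ k) * poch q q k)
    cross {k} k≤M = begin
      sgn k * q ^ T k * poch b q (M ∸ℕ k +ℕ j) * poch q q M
        ≡⟨ cong₂ (λ e p → sgn k * q ^ e * p * poch q q M) (T≡C2 k) (poch-+ b (M ∸ℕ k) j) ⟩
      sgn k * q ^ (k C 2 +ℕ k) * (poch b q (M ∸ℕ k) * P) * poch q q M
        ≡⟨ cong₂ (λ u v → sgn k * u * (poch b q (M ∸ℕ k) * P) * v)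
                 (^-distribˡ-+-* q (k C 2) k) (sym (qbinom-poch k (ℕ.m+[n∸m]≡n k≤M))) ⟩
      sgn k * (q ^ (k C 2) * q ^ k) * (poch b q (M ∸ℕ k) * P) * (qbinom M k * (poch q q k * poch q q (M ∸ℕ k)))
        ≡⟨ regroup (sgn k) (q ^ (k C 2)) (q ^ k) (poch b q (M ∸ℕ k)) P (qbinom M k) (poch q q k) (poch q q (M ∸ℕ k)) ⟩
      qbinom M k * sgn k * q ^ (k C 2) * q ^ k * 1ℚ * P * (poch q q (M ∸ℕ k) * poch b q (M ∸ℕ k) * poch q q k)
        ≡⟨ cong (λ u → qbinom M k * sgn k * q ^ (k C 2) * q ^ k * u * P * (poch q q (M ∸ℕ k) * poch b q (M ∸ℕ k) * poch q q k))
                (^-zeroˡ (M ∸ℕ k)) ⟨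
      innerTerm M 0 j k * (poch q q (M ∸ℕ k) * poch b q (M ∸ℕ k) * poch q q k)
        ∎
      where
      P : ℚ
      P = poch (b * q ^ (M ∸ℕ k)) q j
      regroup : ∀ s c i B P g Q D → s * (c * i) * (B * P) * (g * (Q * D)) ≡ g * s * c * i * 1ℚ * P * (D * B * Q)
      regroup = solve-∀ ring

linear-combination : ∀ {l r} k₁ k₂ k₃ k₄ {a₁ b₁ a₂ b₂ a₃ b₃ a₄ b₄} →
  a₁ ≡ b₁ → a₂ ≡ b₂ → a₃ ≡ b₃ → a₄ ≡ b₄ →
  l ≡ r + (k₁ * (a₁ - b₁) + k₂ * (a₂ - b₂) + k₃ * (a₃ - b₃) + k₄ * (a₄ - b₄)) → l ≡ r
linear-combination {r = r} k₁ k₂ k₃ k₄ {a₁} {a₂ = a₂} {a₃ = a₃} {a₄ = a₄} refl refl refl refl l≡r+0 =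
  trans l≡r+0 (vanish r k₁ k₂ k₃ k₄ a₁ a₂ a₃ a₄)
  where
  vanish : ∀ r k₁ k₂ k₃ k₄ a₁ a₂ a₃ a₄ →
    r + (k₁ * (a₁ - a₁) + k₂ * (a₂ - a₂) + k₃ * (a₃ - a₃) + k₄ * (a₄ - a₄)) ≡ r
  vanish = solve-∀ ring

-- The certificate behind `Saalschütz.Telescoping.D≡ΔG`: there x = qʲ, y = q^(M+1), z = qʳ,
-- ρ = (c;q)ⱼ/(cq;q)ⱼ, P, Q, U, V, W are the q-binomials of the summand, and the hypotheses are
-- their ratio relations.
wz-certificate : ∀ c x y z ρ P Q U V W →
  ρ * (1ℚ - c * x) ≡ 1ℚ - c →
  x * (1ℚ - x) * Q ≡ (x - y) * P →
  W * Q ≡ (U + y * V) * Q →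
  x * (1ℚ - y) * V * Q ≡ (x - z) * U * Q →
  (1ℚ - c * y) * (x * ρ * (P + x * Q) * W) - (1ℚ - c * (y * z)) * (x * ρ * Q * U)
    ≡ (1ℚ - c) * y * (x * Q * V + P * W)
wz-certificate c x y z ρ P Q U V W hρ h₁ h₂ h₃ =
  linear-combination (- (ρ * W)) (ρ * (x - c * x * x * y)) (ρ * (c * x * y)) (y * (x * Q * V + P * W)) h₁ h₂ h₃ hρ
    (identity c x y z ρ P Q U V W)
  where
  identity : ∀ c x y z ρ P Q U V W →
    (1ℚ - c * y) * (x * ρ * (P + x * Q) * W) - (1ℚ - c * (y * z)) * (x * ρ * Q * U)
      ≡ (1ℚ - c) * y * (x * Q * V + P * W)
        + (- (ρ * W) * (x * (1ℚ - x) * Q - (x - y) * P)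
           + ρ * (x - c * x * x * y) * (W * Q - (U + y * V) * Q)
           + ρ * (c * x * y) * (x * (1ℚ - y) * V * Q - (x - z) * U * Q)
           + y * (x * Q * V + P * W) * (ρ * (1ℚ - c * x) - (1ℚ - c)))
  identity = solve-∀ ring

module Saalschütz (q c : ℚ) where

  open QBinomial q

  ρ : ℕ → ℚ
  ρ j = poch c q j ÷' poch (c * q) q j

  ρ*[1-cqʲ]≡1-c : ∀ j → poch (c * q) q j ≢ 0ℚ → ρ j * (1ℚ - c * q ^ j) ≡ 1ℚ - c
  ρ*[1-cqʲ]≡1-c j cqj≢0 = begin
    poch c q j * inv P * (1ℚ - c * q ^ j)    ≡⟨ swap (poch c q j) (inv P) (1ℚ - c * q ^ j) ⟩
    poch c q j * (1ℚ - c * q ^ j) * inv P    ≡⟨ cong (_* inv P) (poch-shift c j) ⟩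
    (1ℚ - c) * P * inv P                     ≡⟨ *-assoc (1ℚ - c) P (inv P) ⟩
    (1ℚ - c) * (P * inv P)                   ≡⟨ cong ((1ℚ - c) *_) (*-invʳ cqj≢0) ⟩
    (1ℚ - c) * 1ℚ                            ≡⟨ *-identityʳ (1ℚ - c) ⟩
    1ℚ - c                                   ∎
    where
    P : ℚ
    P = poch (c * q) q j
    swap : ∀ a b d → a * b * d ≡ a * d * b
    swap = solve-∀ ring

  saalTerm : ℕ → ℕ → ℕ → ℚ
  saalTerm m r j = sgn j * q ^ (suc j C 2) * ρ j * qbinom m j * qbinom (m +ℕ r ∸ℕ j) m

  saalSum : ℕ → ℕ → ℚ
  saalSum m r = sumTo m (saalTerm m r)

  saalSum-extend : ∀ m r → saalSum m r ≡ sumTo (suc m) (saalTerm m r)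
  saalSum-extend m r = sym (begin
    saalSum m r + sgn (suc m) * q ^ (suc (suc m) C 2) * ρ (suc m) * qbinom m (suc m) * qbinom (m +ℕ r ∸ℕ suc m) m
      ≡⟨ cong (λ b → saalSum m r + sgn (suc m) * q ^ (suc (suc m) C 2) * ρ (suc m) * b * qbinom (m +ℕ r ∸ℕ suc m) m)
              (qbinom-≡0 {m} ℕ.≤-refl) ⟩
    saalSum m r + sgn (suc m) * q ^ (suc (suc m) C 2) * ρ (suc m) * 0ℚ * qbinom (m +ℕ r ∸ℕ suc m) m
      ≡⟨ drop (saalSum m r) (sgn (suc m)) (q ^ (suc (suc m) C 2)) (ρ (suc m)) (qbinom (m +ℕ r ∸ℕ suc m) m) ⟩
    saalSum m r
      ∎)
    where
    drop : ∀ a s k d b → a + s * k * d * 0ℚ * b ≡ a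
    drop = solve-∀ ring

  module Telescoping (M r : ℕ) (cq[1+M]≢0 : poch (c * q) q (suc M) ≢ 0ℚ) where

    y z : ℚ
    y = q ^ suc M
    z = q ^ r

    D : ℕ → ℚ
    D j = (1ℚ - c * q * q ^ M) * saalTerm (suc M) r j - (1ℚ - c * q * q ^ (M +ℕ r)) * saalTerm M r j

    G : ℕ → ℚ
    G zero    = 0ℚ
    G (suc j) = sgn j * q ^ (suc j C 2) * y * (1ℚ - c) * qbinom M j * qbinom (M +ℕ r ∸ℕ j) (suc M)

    cqⱼ≢0 : ∀ {j} → j ≤ suc M → poch (c * q) q j ≢ 0ℚ
    cqⱼ≢0 = poch-≢0 cq[1+M]≢0

    ΔG-base : D 0 ≡ G 1 - G 0
    ΔG-base = begin
      (1ℚ - c * q * q ^ M) * (1ℚ * 1ℚ * ρ 0 * 1ℚ * (U + y * V))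
        - (1ℚ - c * q * q ^ (M +ℕ r)) * (1ℚ * 1ℚ * ρ 0 * 1ℚ * U)
        ≡⟨ cong (λ t → (1ℚ - c * q * q ^ M) * (1ℚ * 1ℚ * ρ 0 * 1ℚ * (U + y * V))
                         - (1ℚ - c * q * t) * (1ℚ * 1ℚ * ρ 0 * 1ℚ * U))
                (^-distribˡ-+-* q M r) ⟩
      (1ℚ - c * q * q ^ M) * (1ℚ * 1ℚ * ρ 0 * 1ℚ * (U + y * V))
        - (1ℚ - c * q * (q ^ M * z)) * (1ℚ * 1ℚ * ρ 0 * 1ℚ * U)
        ≡⟨ shape (ρ 0) c q (q ^ M) z U V ⟩
      (1ℚ - c * y) * (1ℚ * ρ 0 * (0ℚ + 1ℚ * 1ℚ) * (U + y * V)) - (1ℚ - c * (y * z)) * (1ℚ * ρ 0 * 1ℚ * U)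
        ≡⟨ wz-certificate c 1ℚ y z (ρ 0) 0ℚ 1ℚ U V (U + y * V)
             (ρ*[1-cqʲ]≡1-c 0 (cqⱼ≢0 z≤n)) (trivial y) refl
             (cong (_* 1ℚ) (qbinom-ratio′ (M +ℕ r) M (λ _ → ℕ.m+n∸m≡n M r))) ⟩
      (1ℚ - c) * y * (1ℚ * 1ℚ * V + 0ℚ * (U + y * V))
        ≡⟨ unshape c y U V ⟩
      1ℚ * 1ℚ * y * (1ℚ - c) * 1ℚ * V - 0ℚ
        ∎
      where
      U V : ℚ
      U = qbinom (M +ℕ r) M
      V = qbinom (M +ℕ r) (suc M)
      trivial : ∀ y → 1ℚ * (1ℚ - 1ℚ) * 1ℚ ≡ (1ℚ - y) * 0ℚ
      trivial = solve-∀ ring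
      shape : ∀ ρ c q x z U V →
        (1ℚ - c * q * x) * (1ℚ * 1ℚ * ρ * 1ℚ * (U + x * q * V)) - (1ℚ - c * q * (x * z)) * (1ℚ * 1ℚ * ρ * 1ℚ * U)
          ≡ (1ℚ - c * (x * q)) * (1ℚ * ρ * (0ℚ + 1ℚ * 1ℚ) * (U + x * q * V))
              - (1ℚ - c * (x * q * z)) * (1ℚ * ρ * 1ℚ * U)
      shape = solve-∀ ring
      unshape : ∀ c y U V →
        (1ℚ - c) * y * (1ℚ * 1ℚ * V + 0ℚ * (U + y * V)) ≡ 1ℚ * 1ℚ * y * (1ℚ - c) * 1ℚ * V - 0ℚ
      unshape = solve-∀ ring

    module Step (J : ℕ) (J≤M : J ≤ M) where

      x : ℚ
      x = q ^ suc J
      s′ : ℕ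
      s′ = M +ℕ r ∸ℕ suc J
      P Q U V W : ℚ
      P = qbinom M J
      Q = qbinom M (suc J)
      U = qbinom s′ M
      V = qbinom s′ (suc M)
      W = qbinom (M +ℕ r ∸ℕ J) (suc M)

      J<M⇒J<M+r : suc J ≤ M → suc J ≤ M +ℕ r
      J<M⇒J<M+r J<M = ℕ.≤-trans J<M (ℕ.m≤m+n M r)

      ratio-Q : x * (1ℚ - x) * Q ≡ (x - y) * P
      ratio-Q = qbinom-ratio′ M J (λ _ → cong suc (ℕ.m+[n∸m]≡n J≤M))

      pascal-W : W * Q ≡ (U + y * V) * Q
      pascal-W = qbinom-*-cong M (suc J) (λ J<M → cong (λ n → qbinom n (suc M)) (ℕ.+-∸-assoc 1 (J<M⇒J<M+r J<M)))

      ratio-V : x * (1ℚ - y) * V * Q ≡ (x - z) * U * Q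
      ratio-V = qbinom-*-cong M (suc J) (λ J<M → qbinom-ratio′ s′ M (exponent J<M))
        where
        exponent : suc J ≤ M → M ≤ s′ → suc J +ℕ (s′ ∸ℕ M) ≡ r
        exponent J<M M≤s′ = ℕ.+-cancelʳ-≡ M (suc J +ℕ (s′ ∸ℕ M)) r (begin
          suc J +ℕ (s′ ∸ℕ M) +ℕ M     ≡⟨ ℕ.+-assoc (suc J) (s′ ∸ℕ M) M ⟩
          suc J +ℕ (s′ ∸ℕ M +ℕ M)     ≡⟨ cong (suc J +ℕ_) (ℕ.m∸n+n≡m M≤s′) ⟩
          suc J +ℕ s′                 ≡⟨ ℕ.+-comm (suc J) s′ ⟩
          s′ +ℕ suc J                 ≡⟨ ℕ.m∸n+n≡m (J<M⇒J<M+r J<M) ⟩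
          M +ℕ r                      ≡⟨ ℕ.+-comm M r ⟩
          r +ℕ M                      ∎)

      ΔG-step : D (suc J) ≡ G (suc (suc J)) - G (suc J)
      ΔG-step = begin
        (1ℚ - c * q * q ^ M) * (s * - 1ℚ * q ^ (suc (suc J) C 2) * ρ′ * (P + x * Q) * W)
          - (1ℚ - c * q * q ^ (M +ℕ r)) * (s * - 1ℚ * q ^ (suc (suc J) C 2) * ρ′ * Q * U)
          ≡⟨ cong₂ (λ e t → (1ℚ - c * q * q ^ M) * (s * - 1ℚ * e * ρ′ * (P + x * Q) * W)
                              - (1ℚ - c * q * t) * (s * - 1ℚ * e * ρ′ * Q * U))
                   (^-C2-suc q (suc J)) (^-distribˡ-+-* q M r) ⟩
        (1ℚ - c * q * q ^ M) * (s * - 1ℚ * (K * x) * ρ′ * (P + x * Q) * W)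
          - (1ℚ - c * q * (q ^ M * z)) * (s * - 1ℚ * (K * x) * ρ′ * Q * U)
          ≡⟨ factor s K x ρ′ P Q U W c q (q ^ M) z ⟩
        s * - 1ℚ * K * ((1ℚ - c * y) * (x * ρ′ * (P + x * Q) * W) - (1ℚ - c * (y * z)) * (x * ρ′ * Q * U))
          ≡⟨ cong (s * - 1ℚ * K *_) (wz-certificate c x y z ρ′ P Q U V W
                                       (ρ*[1-cqʲ]≡1-c (suc J) (cqⱼ≢0 (s≤s J≤M))) ratio-Q pascal-W ratio-V) ⟩
        s * - 1ℚ * K * ((1ℚ - c) * y * (x * Q * V + P * W))
          ≡⟨ distribute s K x y c P Q V W ⟩
        s * - 1ℚ * (K * x) * y * (1ℚ - c) * Q * V - s * K * y * (1ℚ - c) * P * W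
          ≡⟨ cong (λ e → s * - 1ℚ * e * y * (1ℚ - c) * Q * V - s * K * y * (1ℚ - c) * P * W) (^-C2-suc q (suc J)) ⟨
        G (suc (suc J)) - G (suc J)
          ∎
        where
        s K ρ′ : ℚ
        s = sgn J
        K = q ^ (suc J C 2)
        ρ′ = ρ (suc J)
        factor : ∀ s K x ρ P Q U W c q m z →
          (1ℚ - c * q * m) * (s * - 1ℚ * (K * x) * ρ * (P + x * Q) * W)
            - (1ℚ - c * q * (m * z)) * (s * - 1ℚ * (K * x) * ρ * Q * U)
            ≡ s * - 1ℚ * K * ((1ℚ - c * (m * q)) * (x * ρ * (P + x * Q) * W) - (1ℚ - c * (m * q * z)) * (x * ρ * Q * U))
        factor = solve-∀ ring
        distribute : ∀ s K x y c P Q V W →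
          s * - 1ℚ * K * ((1ℚ - c) * y * (x * Q * V + P * W))
            ≡ s * - 1ℚ * (K * x) * y * (1ℚ - c) * Q * V - s * K * y * (1ℚ - c) * P * W
        distribute = solve-∀ ring

    D≡ΔG : ∀ j → j ≤ suc M → D j ≡ G (suc j) - G j
    D≡ΔG zero    _         = ΔG-base
    D≡ΔG (suc J) (s≤s J≤M) = Step.ΔG-step J J≤M

    G-last : G (suc (suc M)) ≡ 0ℚ
    G-last = trans (cong (λ b → sgn (suc M) * q ^ (suc (suc M) C 2) * y * (1ℚ - c) * b * qbinom (M +ℕ r ∸ℕ suc M) (suc M))
                         (qbinom-≡0 {M} ℕ.≤-refl))
                   (zero-factor (sgn (suc M)) (q ^ (suc (suc M) C 2)) y (1ℚ - c) (qbinom (M +ℕ r ∸ℕ suc M) (suc M)))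
      where
      zero-factor : ∀ s k y d b → s * k * y * d * 0ℚ * b ≡ 0ℚ
      zero-factor = solve-∀ ring

    saalSum-rec : (1ℚ - c * q * q ^ M) * saalSum (suc M) r ≡ (1ℚ - c * q * q ^ (M +ℕ r)) * saalSum M r
    saalSum-rec = x-y≡0⇒x≡y (α * saalSum (suc M) r) (β * saalSum M r) (begin
      α * saalSum (suc M) r - β * saalSum M r
        ≡⟨ cong (λ t → α * saalSum (suc M) r - β * t) (saalSum-extend M r) ⟩
      α * saalSum (suc M) r - β * sumTo (suc M) (saalTerm M r)
        ≡⟨ cong₂ _-_ (sumTo-*ˡ (suc M) α (saalTerm (suc M) r)) (sumTo-*ˡ (suc M) β (saalTerm M r)) ⟨
      sumTo (suc M) (λ j → α * saalTerm (suc M) r j) - sumTo (suc M) (λ j → β * saalTerm M r j)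
        ≡⟨ sumTo-minus (suc M) (λ j → α * saalTerm (suc M) r j) (λ j → β * saalTerm M r j) ⟨
      sumTo (suc M) D                           ≡⟨ sumTo-cong (suc M) D≡ΔG ⟩
      sumTo (suc M) (λ j → G (suc j) - G j)     ≡⟨ sumTo-telescope (suc M) G ⟩
      G (suc (suc M)) - 0ℚ                      ≡⟨ cong (_- 0ℚ) G-last ⟩
      0ℚ - 0ℚ                                   ≡⟨ +-inverseʳ 0ℚ ⟩
      0ℚ                                        ∎)
      where
      α β : ℚ
      α = 1ℚ - c * q * q ^ M
      β = 1ℚ - c * q * q ^ (M +ℕ r)

  -- saalSum m r = [m+r m] ₃φ₂(q⁻ᵐ, q⁻ʳ, c; cq, q⁻ᵐ⁻ʳ; q, q), a terminating balanced series, so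
  -- this is the q-Pfaff–Saalschütz sum with denominators cleared.
  saalschütz : ∀ m r → poch (c * q) q (m +ℕ r) ≢ 0ℚ →
    saalSum m r * (poch (c * q) q m * poch (c * q) q r) ≡ poch (c * q) q (m +ℕ r)
  saalschütz zero    r _ = begin
    1ℚ * 1ℚ * ρ 0 * 1ℚ * 1ℚ * (1ℚ * poch (c * q) q r)
      ≡⟨ cong (λ t → 1ℚ * 1ℚ * t * 1ℚ * 1ℚ * (1ℚ * poch (c * q) q r)) ρ0≡1 ⟩
    1ℚ * 1ℚ * 1ℚ * 1ℚ * 1ℚ * (1ℚ * poch (c * q) q r)
      ≡⟨ units (poch (c * q) q r) ⟩
    poch (c * q) q r
      ∎
    where
    ρ0≡1 : ρ 0 ≡ 1ℚ
    ρ0≡1 = x≡z*d⇒x÷'d≡z {x = 1ℚ} {d = 1ℚ} {z = 1ℚ} (λ ()) (sym (*-identityˡ 1ℚ))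
    units : ∀ p → 1ℚ * 1ℚ * 1ℚ * 1ℚ * 1ℚ * (1ℚ * p) ≡ p
    units = solve-∀ ring
  saalschütz (suc m) r cq[1+m+r]≢0 = begin
    saalSum (suc m) r * (Pm * (1ℚ - c * q * q ^ m) * Pr)
      ≡⟨ regroup (saalSum (suc m) r) Pm Pr (1ℚ - c * q * q ^ m) ⟩
    (1ℚ - c * q * q ^ m) * saalSum (suc m) r * (Pm * Pr)
      ≡⟨ cong (_* (Pm * Pr)) (Telescoping.saalSum-rec m r cq[1+m]≢0) ⟩
    (1ℚ - c * q * q ^ (m +ℕ r)) * saalSum m r * (Pm * Pr)
      ≡⟨ *-assoc (1ℚ - c * q * q ^ (m +ℕ r)) (saalSum m r) (Pm * Pr) ⟩
    (1ℚ - c * q * q ^ (m +ℕ r)) * (saalSum m r * (Pm * Pr))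
      ≡⟨ cong ((1ℚ - c * q * q ^ (m +ℕ r)) *_) (saalschütz m r cq[m+r]≢0) ⟩
    (1ℚ - c * q * q ^ (m +ℕ r)) * poch (c * q) q (m +ℕ r)
      ≡⟨ *-comm (1ℚ - c * q * q ^ (m +ℕ r)) (poch (c * q) q (m +ℕ r)) ⟩
    poch (c * q) q (suc m +ℕ r)
      ∎
    where
    Pm Pr : ℚ
    Pm = poch (c * q) q m
    Pr = poch (c * q) q r
    cq[1+m]≢0 : poch (c * q) q (suc m) ≢ 0ℚ
    cq[1+m]≢0 = poch-≢0 cq[1+m+r]≢0 (ℕ.m≤m+n (suc m) r)
    cq[m+r]≢0 : poch (c * q) q (m +ℕ r) ≢ 0ℚ
    cq[m+r]≢0 = poch-≢0 cq[1+m+r]≢0 (ℕ.n≤1+n (m +ℕ r))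
    regroup : ∀ s p r d → s * (p * d * r) ≡ d * s * (p * r)
    regroup = solve-∀ ring

module Expansion (N : ℕ) (q b c : ℚ)
  (qN≢0 : poch q q N ≢ 0ℚ) (bN≢0 : poch b q N ≢ 0ℚ) (cqN≢0 : poch (c * q) q N ≢ 0ℚ) where

  open QBinomial q
  open InnerSum q b
  open Saalschütz q c

  lhsTerm : ℕ → ℕ → ℚ
  lhsTerm m j = sgn m * b ^ m * q ^ (m C 2) * saalTerm m (N ∸ℕ m) j

  lhs-expansion :
    sumTo N (λ n → sgn n * (b ^ n) * (q ^ (n C 2)) * (poch (c * q) q N ÷' (poch (c * q) q n * poch (c * q) q (N ∸ℕ n))))
      ≡ sumTo N (λ m → sumTo m (lhsTerm m))
  lhs-expansion = sumTo-cong N λ n n≤N →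
    trans (cong (sgn n * b ^ n * q ^ (n C 2) *_) (cq-binomial n≤N))
          (sym (sumTo-*ˡ n (sgn n * b ^ n * q ^ (n C 2)) (saalTerm n (N ∸ℕ n))))
    where
    cq-binomial : ∀ {n} → n ≤ N → poch (c * q) q N ÷' (poch (c * q) q n * poch (c * q) q (N ∸ℕ n))
      ≡ saalSum n (N ∸ℕ n)
    cq-binomial {n} n≤N = x≡z*d⇒x÷'d≡z (x*y≢0 (poch-≢0 cqN≢0 n≤N) (poch-≢0 cqN≢0 (ℕ.m∸n≤m N n))) (begin
      poch (c * q) q N
        ≡⟨ cong (poch (c * q) q) (ℕ.m+[n∸m]≡n n≤N) ⟨
      poch (c * q) q (n +ℕ (N ∸ℕ n))
        ≡⟨ saalschütz n (N ∸ℕ n) (poch-≢0 cqN≢0 (ℕ.≤-reflexive (ℕ.m+[n∸m]≡n n≤N))) ⟨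
      saalSum n (N ∸ℕ n) * (poch (c * q) q n * poch (c * q) q (N ∸ℕ n))
        ∎)

  rhsTerm : ℕ → ℕ → ℚ
  rhsTerm j k =
    (sgn k * (b ^ j) * (q ^ ((j *ℕ j) +ℕ T k)) * poch c q j
      * (poch q q (N ∸ℕ j) * poch b q (N ∸ℕ j)) * poch b q (N ∸ℕ k))
    ÷' ((poch q q j * poch b q j * poch (c * q) q j)
        * (poch q q (N ∸ℕ j ∸ℕ k) * poch b q (N ∸ℕ j ∸ℕ k))
        * poch q q k * poch q q (N ∸ℕ (2 *ℕ j)))

  outer : ℕ → ℚ
  outer j = b ^ j * q ^ (j *ℕ j) * ρ j * qbinom (N ∸ℕ j) j

  binomialTerm : ℕ → ℕ → ℚ
  binomialTerm j i = qbinom (N ∸ℕ j ∸ℕ j) i * sgn i * q ^ (i C 2) * (b * q ^ j) ^ i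

  qₙ≢0 : ∀ {n} → n ≤ N → poch q q n ≢ 0ℚ
  qₙ≢0 = poch-≢0 qN≢0

  bₙ≢0 : ∀ {n} → n ≤ N → poch b q n ≢ 0ℚ
  bₙ≢0 = poch-≢0 bN≢0

  cqₙ≢0 : ∀ {n} → n ≤ N → poch (c * q) q n ≢ 0ℚ
  cqₙ≢0 = poch-≢0 cqN≢0

  outerFraction : ℕ → ℚ
  outerFraction j = (b ^ j * q ^ (j *ℕ j) * poch c q j * (poch q q (N ∸ℕ j) * poch b q (N ∸ℕ j)))
                    ÷' (poch q q j * poch b q j * poch (c * q) q j * poch q q (N ∸ℕ (2 *ℕ j)))

  innerFraction : ℕ → ℕ → ℚ
  innerFraction j k = (sgn k * q ^ T k * poch b q (N ∸ℕ k))
                      ÷' (poch q q (N ∸ℕ j ∸ℕ k) * poch b q (N ∸ℕ j ∸ℕ k) * poch q q k)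

  rhsTerm-factor : ∀ j k → j ≤ N → k ≤ N → rhsTerm j k ≡ outerFraction j * innerFraction j k
  rhsTerm-factor j k j≤N k≤N = begin
    rhsTerm j k                 ≡⟨ cong₂ _÷'_ numerator denominator ⟩
    (X * Xₖ) ÷' (Y * Yₖ)        ≡⟨ ÷'-*-interchange {x = X} {u = Xₖ} Y≢0 Yₖ≢0 ⟩
    (X ÷' Y) * (Xₖ ÷' Yₖ)       ∎
    where
    M : ℕ
    M = N ∸ℕ j
    X Y Xₖ Yₖ : ℚ
    X = b ^ j * q ^ (j *ℕ j) * poch c q j * (poch q q M * poch b q M)
    Y = poch q q j * poch b q j * poch (c * q) q j * poch q q (N ∸ℕ (2 *ℕ j))
    Xₖ = sgn k * q ^ T k * poch b q (N ∸ℕ k)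
    Yₖ = poch q q (M ∸ℕ k) * poch b q (M ∸ℕ k) * poch q q k
    M∸k≤N : M ∸ℕ k ≤ N
    M∸k≤N = ℕ.≤-trans (ℕ.m∸n≤m M k) (ℕ.m∸n≤m N j)
    Y≢0 : Y ≢ 0ℚ
    Y≢0 = x*y≢0 (x*y≢0 (x*y≢0 (qₙ≢0 j≤N) (bₙ≢0 j≤N)) (cqₙ≢0 j≤N)) (qₙ≢0 (ℕ.m∸n≤m N (2 *ℕ j)))
    Yₖ≢0 : Yₖ ≢ 0ℚ
    Yₖ≢0 = x*y≢0 (x*y≢0 (qₙ≢0 M∸k≤N) (bₙ≢0 M∸k≤N)) (qₙ≢0 k≤N)
    numerator : sgn k * (b ^ j) * (q ^ ((j *ℕ j) +ℕ T k)) * poch c q j * (poch q q M * poch b q M) * poch b q (N ∸ℕ k)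
                ≡ X * Xₖ
    numerator = trans (cong (λ e → sgn k * (b ^ j) * e * poch c q j * (poch q q M * poch b q M) * poch b q (N ∸ℕ k))
                            (^-distribˡ-+-* q (j *ℕ j) (T k)))
                      (regroup (sgn k) (b ^ j) (q ^ (j *ℕ j)) (q ^ T k) (poch c q j)
                               (poch q q M) (poch b q M) (poch b q (N ∸ℕ k)))
      where
      regroup : ∀ s bʲ x y p u v w → s * bʲ * (x * y) * p * (u * v) * w ≡ bʲ * x * p * (u * v) * (s * y * w)
      regroup = solve-∀ ring
    denominator : (poch q q j * poch b q j * poch (c * q) q j) * (poch q q (M ∸ℕ k) * poch b q (M ∸ℕ k))
                    * poch q q k * poch q q (N ∸ℕ (2 *ℕ j))
                  ≡ Y * Yₖ
    denominator = regroup (poch q q j * poch b q j * poch (c * q) q j) (poch q q (M ∸ℕ k)) (poch b q (M ∸ℕ k))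
                          (poch q q k) (poch q q (N ∸ℕ (2 *ℕ j)))
      where
      regroup : ∀ a u v w z → a * (u * v) * w * z ≡ a * z * (u * v * w)
      regroup = solve-∀ ring

  innerFraction-sum : ∀ j → j +ℕ j ≤ N → sumTo (N ∸ℕ j) (innerFraction j) ≡ 1ℚ
  innerFraction-sum j j+j≤N = begin
    sumTo M (innerFraction j)
      ≡⟨ sumTo-cong M (λ k k≤M → cong (λ n → (sgn k * q ^ T k * poch b q n)
                                               ÷' (poch q q (M ∸ℕ k) * poch b q (M ∸ℕ k) * poch q q k))
                                      (reindex k≤M)) ⟩
    sumTo M (λ k → (sgn k * q ^ T k * poch b q (M ∸ℕ k +ℕ j)) ÷' (poch q q (M ∸ℕ k) * poch b q (M ∸ℕ k) * poch q q k))
      ≡⟨ inner-sum (qₙ≢0 (ℕ.m∸n≤m N j)) (bₙ≢0 (ℕ.m∸n≤m N j)) (ℕ.m+n≤o⇒m≤o∸n j j+j≤N) ⟩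
    1ℚ
      ∎
    where
    M : ℕ
    M = N ∸ℕ j
    reindex : ∀ {k} → k ≤ M → N ∸ℕ k ≡ M ∸ℕ k +ℕ j
    reindex {k} k≤M = begin
      N ∸ℕ k               ≡⟨ cong (_∸ℕ k) (ℕ.m∸n+n≡m (ℕ.≤-trans (ℕ.m≤m+n j j) j+j≤N)) ⟨
      M +ℕ j ∸ℕ k          ≡⟨ ℕ.+-∸-comm j k≤M ⟩
      M ∸ℕ k +ℕ j          ∎

  outerFraction-eval : ∀ j → j +ℕ j ≤ N → outerFraction j ≡ outer j * poch (b * q ^ j) q (N ∸ℕ j ∸ℕ j)
  outerFraction-eval j j+j≤N = x≡z*d⇒x÷'d≡z Y≢0 (begin
    b ^ j * q ^ (j *ℕ j) * poch c q j * (poch q q M * poch b q M)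
      ≡⟨ cong₂ (λ u v → b ^ j * q ^ (j *ℕ j) * poch c q j * (u * v))
               (sym (qbinom-poch j (ℕ.m+[n∸m]≡n j≤M)))
               (trans (cong (poch b q) (sym (ℕ.m+[n∸m]≡n j≤M))) (poch-+ b j (M ∸ℕ j))) ⟩
    Z
      ≡⟨ *-identityʳ Z ⟨
    Z * 1ℚ
      ≡⟨ cong (Z *_) (*-invʳ (cqₙ≢0 j≤N)) ⟨
    Z * (poch (c * q) q j * inv (poch (c * q) q j))
      ≡⟨ regroup (b ^ j) (q ^ (j *ℕ j)) (poch c q j) g (poch q q j) (poch q q (M ∸ℕ j)) (poch b q j) P
                 (poch (c * q) q j) (inv (poch (c * q) q j)) ⟩
    outer j * P * (poch q q j * poch b q j * poch (c * q) q j * poch q q (M ∸ℕ j))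
      ≡⟨ cong (λ n → outer j * P * (poch q q j * poch b q j * poch (c * q) q j * poch q q n)) N∸2j≡M∸j ⟨
    outer j * P * Y
      ∎)
    where
    M : ℕ
    M = N ∸ℕ j
    P g : ℚ
    P = poch (b * q ^ j) q (M ∸ℕ j)
    g = qbinom M j
    j≤N : j ≤ N
    j≤N = ℕ.≤-trans (ℕ.m≤m+n j j) j+j≤N
    j≤M : j ≤ M
    j≤M = ℕ.m+n≤o⇒m≤o∸n j j+j≤N
    Y : ℚ
    Y = poch q q j * poch b q j * poch (c * q) q j * poch q q (N ∸ℕ (2 *ℕ j))
    Y≢0 : Y ≢ 0ℚ
    Y≢0 = x*y≢0 (x*y≢0 (x*y≢0 (qₙ≢0 j≤N) (bₙ≢0 j≤N)) (cqₙ≢0 j≤N)) (qₙ≢0 (ℕ.m∸n≤m N (2 *ℕ j)))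
    Z : ℚ
    Z = b ^ j * q ^ (j *ℕ j) * poch c q j * (g * (poch q q j * poch q q (M ∸ℕ j)) * (poch b q j * P))
    N∸2j≡M∸j : N ∸ℕ (2 *ℕ j) ≡ M ∸ℕ j
    N∸2j≡M∸j = trans (cong (N ∸ℕ_) (double j)) (sym (ℕ.∸-+-assoc N j j))
      where
      double : ∀ j → 2 *ℕ j ≡ j +ℕ j
      double = ℕ-Solver.solve-∀
    regroup : ∀ bʲ x p g u v w P d d′ →
      bʲ * x * p * (g * (u * v) * (w * P)) * (d * d′) ≡ bʲ * x * (p * d′) * g * P * (u * w * d * v)
    regroup = solve-∀ ring

  row-sum : ∀ j → j +ℕ j ≤ N → sumTo (N ∸ℕ j) (rhsTerm j) ≡ outer j * poch (b * q ^ j) q (N ∸ℕ j ∸ℕ j)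
  row-sum j j+j≤N = begin
    sumTo (N ∸ℕ j) (rhsTerm j)
      ≡⟨ sumTo-cong (N ∸ℕ j) (λ k k≤N∸j → rhsTerm-factor j k j≤N (ℕ.≤-trans k≤N∸j (ℕ.m∸n≤m N j))) ⟩
    sumTo (N ∸ℕ j) (λ k → outerFraction j * innerFraction j k)
      ≡⟨ sumTo-*ˡ (N ∸ℕ j) (outerFraction j) (innerFraction j) ⟩
    outerFraction j * sumTo (N ∸ℕ j) (innerFraction j)
      ≡⟨ cong (outerFraction j *_) (innerFraction-sum j j+j≤N) ⟩
    outerFraction j * 1ℚ
      ≡⟨ *-identityʳ (outerFraction j) ⟩
    outerFraction j
      ≡⟨ outerFraction-eval j j+j≤N ⟩
    outer j * poch (b * q ^ j) q (N ∸ℕ j ∸ℕ j)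
      ∎
    where
    j≤N : j ≤ N
    j≤N = ℕ.≤-trans (ℕ.m≤m+n j j) j+j≤N

  outer-≡0 : ∀ j → N < j +ℕ j → outer j ≡ 0ℚ
  outer-≡0 (suc j) N<j+j = trans (cong (b ^ suc j * q ^ (suc j *ℕ suc j) * ρ (suc j) *_)
                                       (qbinom-≡0 (ℕ.m<n+o⇒m∸n<o N (suc j) N<j+j)))
                                 (*-zeroʳ (b ^ suc j * q ^ (suc j *ℕ suc j) * ρ (suc j)))

  row-expansion : ∀ j → outer j * poch (b * q ^ j) q (N ∸ℕ j ∸ℕ j)
    ≡ sumTo (N ∸ℕ j) (λ i → outer j * binomialTerm j i)
  row-expansion j = begin
    outer j * poch (b * q ^ j) q (N ∸ℕ j ∸ℕ j)
      ≡⟨ cong (outer j *_) (q-binomial-theorem (b * q ^ j) (N ∸ℕ j ∸ℕ j)) ⟩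
    outer j * sumTo (N ∸ℕ j ∸ℕ j) (binomialTerm j)
      ≡⟨ sumTo-*ˡ (N ∸ℕ j ∸ℕ j) (outer j) (binomialTerm j) ⟨
    sumTo (N ∸ℕ j ∸ℕ j) (λ i → outer j * binomialTerm j i)
      ≡⟨ sumTo-extend (λ i → outer j * binomialTerm j i) (ℕ.m∸n≤m (N ∸ℕ j) j) vanish ⟨
    sumTo (N ∸ℕ j) (λ i → outer j * binomialTerm j i)
      ∎
    where
    vanish : ∀ i → N ∸ℕ j ∸ℕ j < i → i ≤ N ∸ℕ j → outer j * binomialTerm j i ≡ 0ℚ
    vanish i N∸j∸j<i _ = trans (cong (λ g → outer j * (g * sgn i * q ^ (i C 2) * (b * q ^ j) ^ i)) (qbinom-≡0 N∸j∸j<i))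
                               (zero-factor (outer j) (sgn i) (q ^ (i C 2)) ((b * q ^ j) ^ i))
      where
      zero-factor : ∀ a s k x → a * (0ℚ * s * k * x) ≡ 0ℚ
      zero-factor = solve-∀ ring

  term-identity : ∀ {j m} → j ≤ m → m ≤ N → outer j * binomialTerm j (m ∸ℕ j) ≡ lhsTerm m j
  term-identity {j} {m} j≤m m≤N = begin
    bʲ * q ^ (j *ℕ j) * ρ j * g₁ * (g₂ * sgn d * q ^ (d C 2) * (b * q ^ j) ^ d)
      ≡⟨ cong (λ t → bʲ * q ^ (j *ℕ j) * ρ j * g₁ * (g₂ * sgn d * q ^ (d C 2) * t))
              (trans (^-distribʳ-* b (q ^ j) d) (cong (b ^ d *_) (^-*-assoc q j d))) ⟩
    bʲ * q ^ (j *ℕ j) * ρ j * g₁ * (g₂ * sgn d * q ^ (d C 2) * (b ^ d * q ^ (j *ℕ d)))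
      ≡⟨ regroup₁ bʲ (q ^ (j *ℕ j)) (ρ j) g₁ g₂ (sgn d) (q ^ (d C 2)) (b ^ d) (q ^ (j *ℕ d)) ⟩
    (bʲ * b ^ d) * (q ^ (j *ℕ j) * q ^ (d C 2) * q ^ (j *ℕ d)) * sgn d * ρ j * (g₁ * g₂)
      ≡⟨ cong₂ (λ u v → u * v * sgn d * ρ j * (g₁ * g₂)) b-part q-part ⟩
    b ^ m * (q ^ (m C 2) * q ^ (suc j C 2)) * sgn d * ρ j * (g₁ * g₂)
      ≡⟨ cong₂ (λ u v → b ^ m * (q ^ (m C 2) * q ^ (suc j C 2)) * u * ρ j * v) (sgn-cancel {j} {d} j+d≡m) (sym revision) ⟨
    b ^ m * (q ^ (m C 2) * q ^ (suc j C 2)) * (sgn m * sgn j) * ρ j * (qbinom m j * qbinom (N ∸ℕ j) m)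
      ≡⟨ regroup₂ (b ^ m) (q ^ (m C 2)) (q ^ (suc j C 2)) (sgn m) (sgn j) (ρ j) (qbinom m j) (qbinom (N ∸ℕ j) m) ⟩
    sgn m * b ^ m * q ^ (m C 2) * (sgn j * q ^ (suc j C 2) * ρ j * qbinom m j * qbinom (N ∸ℕ j) m)
      ≡⟨ cong (λ n → sgn m * b ^ m * q ^ (m C 2) * (sgn j * q ^ (suc j C 2) * ρ j * qbinom m j * qbinom (n ∸ℕ j) m))
              (ℕ.m+[n∸m]≡n m≤N) ⟨
    lhsTerm m j
      ∎
    where
    d : ℕ
    d = m ∸ℕ j
    bʲ g₁ g₂ : ℚ
    bʲ = b ^ j
    g₁ = qbinom (N ∸ℕ j) j
    g₂ = qbinom (N ∸ℕ j ∸ℕ j) d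
    j+d≡m : j +ℕ d ≡ m
    j+d≡m = ℕ.m+[n∸m]≡n j≤m
    b-part : bʲ * b ^ d ≡ b ^ m
    b-part = trans (sym (^-distribˡ-+-* b j d)) (cong (b ^_) j+d≡m)
    q-part : q ^ (j *ℕ j) * q ^ (d C 2) * q ^ (j *ℕ d) ≡ q ^ (m C 2) * q ^ (suc j C 2)
    q-part = trans (^-C2-square q j d) (cong (λ n → q ^ (n C 2) * q ^ (suc j C 2)) j+d≡m)
    revision : g₁ * g₂ ≡ qbinom m j * qbinom (N ∸ℕ j) m
    revision = trans (sym (qbinom-revision (qₙ≢0 (ℕ.m∸n≤m N j)) j≤m)) (*-comm (qbinom (N ∸ℕ j) m) (qbinom m j))
    regroup₁ : ∀ bʲ x r g₁ g₂ s y bᵈ z → bʲ * x * r * g₁ * (g₂ * s * y * (bᵈ * z))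
      ≡ (bʲ * bᵈ) * (x * y * z) * s * r * (g₁ * g₂)
    regroup₁ = solve-∀ ring
    regroup₂ : ∀ bᵐ x y sₘ sⱼ r g h →
      bᵐ * (x * y) * (sₘ * sⱼ) * r * (g * h) ≡ sₘ * bᵐ * x * (sⱼ * y * r * g * h)
    regroup₂ = solve-∀ ring

  rhs-expansion : sumTo (N divℕ 2) (λ j → sumTo (N ∸ℕ j) (rhsTerm j)) ≡ sumTo N (λ m → sumTo m (lhsTerm m))
  rhs-expansion = begin
    sumTo (N divℕ 2) (λ j → sumTo (N ∸ℕ j) (rhsTerm j))
      ≡⟨ sumTo-cong (N divℕ 2) (λ j j≤N/2 → row-sum j (m≤n/2⇒m+m≤n j≤N/2)) ⟩
    sumTo (N divℕ 2) (λ j → outer j * poch (b * q ^ j) q (N ∸ℕ j ∸ℕ j))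
      ≡⟨ sumTo-extend (λ j → outer j * poch (b * q ^ j) q (N ∸ℕ j ∸ℕ j)) (m/n≤m N 2) beyond-half ⟨
    sumTo N (λ j → outer j * poch (b * q ^ j) q (N ∸ℕ j ∸ℕ j))
      ≡⟨ sumTo-cong N (λ j _ → row-expansion j) ⟩
    sumTo N (λ j → sumTo (N ∸ℕ j) (λ i → outer j * binomialTerm j i))
      ≡⟨ sumTo-triangle N (λ j i → outer j * binomialTerm j i) ⟩
    sumTo N (λ m → sumTo m (λ j → outer j * binomialTerm j (m ∸ℕ j)))
      ≡⟨ sumTo-cong N (λ m m≤N → sumTo-cong m (λ j j≤m → term-identity j≤m m≤N)) ⟩
    sumTo N (λ m → sumTo m (lhsTerm m))
      ∎
    where
    beyond-half : ∀ j → N divℕ 2 < j → j ≤ N → outer j * poch (b * q ^ j) q (N ∸ℕ j ∸ℕ j) ≡ 0ℚ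
    beyond-half j N/2<j _ =
      trans (cong (_* poch (b * q ^ j) q (N ∸ℕ j ∸ℕ j))
                  (outer-≡0 j (ℕ.≰⇒> (λ j+j≤N → ℕ.<⇒≱ N/2<j (m+m≤n⇒m≤n/2 j+j≤N)))))
            (*-zeroˡ (poch (b * q ^ j) q (N ∸ℕ j ∸ℕ j)))

mainTheorem5 : (N : ℕ) (q b c : ℚ) →
    poch q q N ≢ 0ℚ → poch b q N ≢ 0ℚ → poch (c * q) q N ≢ 0ℚ →
    sumTo N (λ n → sgn n * (b ^ n) * (q ^ (n C 2))
                   * (poch (c * q) q N ÷' (poch (c * q) q n * poch (c * q) q (N ∸ℕ n))))
    ≡ sumTo (N divℕ 2) (λ j → sumTo (N ∸ℕ j) (λ k →
        (sgn k * (b ^ j) * (q ^ ((j *ℕ j) +ℕ T k)) * poch c q j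
          * (poch q q (N ∸ℕ j) * poch b q (N ∸ℕ j)) * poch b q (N ∸ℕ k))
        ÷' ((poch q q j * poch b q j * poch (c * q) q j)
            * (poch q q (N ∸ℕ j ∸ℕ k) * poch b q (N ∸ℕ j ∸ℕ k))
            * poch q q k * poch q q (N ∸ℕ (2 *ℕ j)))))
mainTheorem5 N q b c qN≢0 bN≢0 cqN≢0 = trans lhs-expansion (sym rhs-expansion)
  where
  open Expansion N q b c qN≢0 bN≢0 cqN≢0
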